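{- Let $k,\ell\ge 3$ be odd, $n=\frac{k\ell+1}{2}$, let $D_0,\dots,D_{n-1}$ be a partition of the edges of $BW_{k,\ell}$ into $n$ plane subgraphs, and let $E_{\text{forced}}$ be a set of forced diagonal edges for this partition. Then one of the subgraphs contains exactly one edge of $E_{\text{forced}}$ and each of the other $n-1$ subgraphs contains exactly two edges of $E_{\text{forced}}$.
   Context: A geometric graph has vertices as points in general position and straight-line edges; it is plane if no two edges share a point of their relative interiors. For odd $k,\ell\ge 3$, $BW_{k,\ell}$ is the complete geometric graph on $k\ell+1$ points: a center $v_0$ and $k$ groups $\mathcal{G}_1,\dots,\mathcal{G}_k$ (clockwise, indices mod $k$) of $\ell$ points each, where group $\mathcal{G}_i$ consists of $\ell$ points that are $\varepsilon$-close (sufficiently small $\varepsilon>0$) to the $i$-th vertex of a regular $k$-gon centered at $v_0$, all points other than $v_0$ are in convex position on the convex hull, and the convex hull of any $\frac{k+1}{2}$ consecutive groups does not contain $v_0$. Edges incident to $v_0$ are radial; edges between hull-consecutive vertices are boundary edges; all others are diagonal. For a non-radial edge $e$, $e^-$ is the open halfplane bounded by the line through $e$ not containing $v_0$; an edge lies in $e^-$ if its relative interior does. For non-radial edges, $e<_cf$ if $e$ lies in $f^-$. A non-radial edge $e$ is maximal in a subgraph $D$ if there is no non-radial edge $e'$ of $D$ with $e<_ce'$. The distance $\operatorname{dist}(e)$ of a non-radial edge is the number of points of $BW_{k,\ell}$ in $e^-$ plus one; $d_i=\frac{k+1}{2}\ell-i$. Groups $\mathcal{G}_i,\mathcal{G}_j$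 are opposite if $|i-j|\in\{\frac{k-1}{2},\frac{k+1}{2}\}$; there are $k$ pairs of opposite groups. A set of forced diagonal edges is a set $E_{\text{forced}}$ obtained by choosing, for each pair $\mathcal{G},\mathcal{G}'$ of opposite groups, $\ell$ distinct diagonal edges $f_1,\dots,f_\ell$ connecting $\mathcal{G}$ and $\mathcal{G}'$, each maximal in the subgraph $D_j$ containing it, with $\operatorname{dist}(f_i)\ge d_i$ for $i=1,\dots,\ell$ (so $|E_{\text{forced}}|=k\ell$). -}

module Defs where

open import Data.Nat using (ℕ; zero; suc; _+_; _*_; _∸_; _≤_; _<_; _≥_; NonZero; _/_)
open import Data.Nat.Properties using (_≟_; _≤?_; _<?_)
open import Data.Fin using (Fin; toℕ) renaming (zero to fzero; suc to fsuc)
import Data.Fin.Properties as FinP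
open import Data.Product using (Σ; _×_; _,_)
open import Data.Sum using (_⊎_)
open import Data.Empty using (⊥)
open import Relation.Nullary using (¬_; Dec; yes; no)
open import Relation.Nullary.Decidable using (_×-dec_; _⊎-dec_; ¬?; isYes)
open import Relation.Binary.PropositionalEquality using (_≡_; _≢_)
open import Data.Bool using (if_then_else_)

-- The N = k * ℓ hull points are Fin N, numbered 0 .. N-1 in clockwise
-- order around the convex hull; hull point p lies in group  p / ℓ
-- (groups numbered 0 .. k-1 clockwise).  The center v₀ is implicit.

-- Edges of the complete geometric graph on {v₀} ∪ hull points:
--   radial p      : the edge v₀ p
--   chord a b _   : the edge between hull points a and b, with a < b
-- (the order proof is irrelevant, so every edge is represented once).
data Edge (N : ℕ) : Set where
  radial : Fin N → Edge N
  chord  : (a b : Fin N) → .(toℕ a < toℕ b) → Edge N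

sumFin : ∀ {m} → (Fin m → ℕ) → ℕ
sumFin {zero}  f = 0
sumFin {suc m} f = f fzero + sumFin (λ i → f (fsuc i))

grp : (ℓ : ℕ) → .{{_ : NonZero ℓ}} → ℕ → ℕ
grp ℓ p = p / ℓ

-- For a chord a < b: the clockwise arc from a to b (strictly between)
-- is the side not containing v₀ iff it spans at most (k-1)/2 group
-- steps (because the hull of any (k+1)/2 consecutive groups misses v₀).
ShortInner : (k ℓ : ℕ) → .{{_ : NonZero ℓ}} → ℕ → ℕ → Set
ShortInner k ℓ a b = grp ℓ b ∸ grp ℓ a ≤ (k ∸ 1) / 2

InMinus : (k ℓ : ℕ) → .{{_ : NonZero ℓ}} → (a b p : ℕ) → Set
InMinus k ℓ a b p =
    (ShortInner k ℓ a b × (a < p × p < b))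
  ⊎ (¬ ShortInner k ℓ a b × (p < a ⊎ b < p))

inMinus? : (k ℓ : ℕ) → .{{_ : NonZero ℓ}} → (a b p : ℕ) → Dec (InMinus k ℓ a b p)
inMinus? k ℓ a b p =
     ((grp ℓ b ∸ grp ℓ a ≤? (k ∸ 1) / 2) ×-dec ((a <? p) ×-dec (p <? b)))
  ⊎-dec (¬? (grp ℓ b ∸ grp ℓ a ≤? (k ∸ 1) / 2) ×-dec ((p <? a) ⊎-dec (b <? p)))

-- dist(e) = number of points of BW_{k,ℓ} in e⁻ plus one
-- (v₀ is never in e⁻; only non-radial edges have a distance).
dist : (k ℓ : ℕ) → .{{_ : NonZero ℓ}} → Edge (k * ℓ) → ℕ
dist k ℓ (radial _)    = 0
dist k ℓ (chord a b _) =
  suc (sumFin {k * ℓ} (λ p → if isYes (inMinus? k ℓ (toℕ a) (toℕ b) (toℕ p)) then 1 else 0))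

-- Two distinct edges share a point of their relative interiors.
Cross : (k ℓ : ℕ) → .{{_ : NonZero ℓ}} → Edge (k * ℓ) → Edge (k * ℓ) → Set
Cross k ℓ (radial p)    (radial q)    = ⊥
Cross k ℓ (radial p)    (chord a b _) = InMinus k ℓ (toℕ a) (toℕ b) (toℕ p)
Cross k ℓ (chord a b _) (radial p)    = InMinus k ℓ (toℕ a) (toℕ b) (toℕ p)
Cross k ℓ (chord a b _) (chord c d _) =
    (toℕ a < toℕ c × toℕ c < toℕ b × toℕ b < toℕ d)
  ⊎ (toℕ c < toℕ a × toℕ a < toℕ d × toℕ d < toℕ b)

Boundary : (N : ℕ) → ℕ → ℕ → Set
Boundary N a b = (b ≡ suc a) ⊎ (a ≡ 0 × suc b ≡ N)

IsDiagonal : (N : ℕ) → Edge N → Set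
IsDiagonal N (radial _)    = ⊥
IsDiagonal N (chord a b _) = ¬ Boundary N (toℕ a) (toℕ b)

ClosedMinus : (k ℓ : ℕ) → .{{_ : NonZero ℓ}} → (a b p : ℕ) → Set
ClosedMinus k ℓ a b p = InMinus k ℓ a b p ⊎ (p ≡ a ⊎ p ≡ b)

LtC : (k ℓ : ℕ) → .{{_ : NonZero ℓ}} → Edge (k * ℓ) → Edge (k * ℓ) → Set
LtC k ℓ (chord a b _) (chord c d _) =
    ClosedMinus k ℓ (toℕ c) (toℕ d) (toℕ a)
  × ClosedMinus k ℓ (toℕ c) (toℕ d) (toℕ b)
  × ¬ (a ≡ c × b ≡ d)
LtC k ℓ _ _ = ⊥

-- A partition of the edges into n subgraphs D_0..D_{n-1}: a colouring.
-- Each part is plane.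
AllPlane : (k ℓ : ℕ) → .{{_ : NonZero ℓ}} → {n : ℕ} → (Edge (k * ℓ) → Fin n) → Set
AllPlane k ℓ col = ∀ e f → col e ≡ col f → ¬ Cross k ℓ e f

MaximalIn : (k ℓ : ℕ) → .{{_ : NonZero ℓ}} → {n : ℕ} → (Edge (k * ℓ) → Fin n) → Edge (k * ℓ) → Set
MaximalIn k ℓ col e = ∀ e' → col e' ≡ col e → ¬ LtC k ℓ e e'

Connects : (k ℓ : ℕ) → .{{_ : NonZero ℓ}} → Edge (k * ℓ) → ℕ → ℕ → Set
Connects k ℓ (radial _)    g g' = ⊥
Connects k ℓ (chord a b _) g g' =
    (grp ℓ (toℕ a) ≡ g × grp ℓ (toℕ b) ≡ g')
  ⊎ (grp ℓ (toℕ a) ≡ g' × grp ℓ (toℕ b) ≡ g)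

Opposite : (k g g' : ℕ) → Set
Opposite k g g' = (g' ∸ g ≡ (k ∸ 1) / 2) ⊎ (g' ∸ g ≡ (k + 1) / 2)

opposite? : (k g g' : ℕ) → Dec (Opposite k g g')
opposite? k g g' = (g' ∸ g ≟ (k ∸ 1) / 2) ⊎-dec (g' ∸ g ≟ (k + 1) / 2)

-- A choice of ℓ edges f_1..f_ℓ (indexed by Fin ℓ, t ↦ f_{t+1}) for every
-- pair {g, g'} of opposite groups, written with g < g'.
ForcedFamily : (k ℓ : ℕ) → Set
ForcedFamily k ℓ =
  (g g' : Fin k) → toℕ g < toℕ g' → Opposite k (toℕ g) (toℕ g') → Fin ℓ → Edge (k * ℓ)

dd : (k ℓ i : ℕ) → ℕ
dd k ℓ i = ((k + 1) / 2) * ℓ ∸ i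

IsForced : (k ℓ : ℕ) → .{{_ : NonZero ℓ}} → {n : ℕ} → (Edge (k * ℓ) → Fin n) → ForcedFamily k ℓ → Set
IsForced k ℓ col F =
    (∀ g g' lt op (t t' : Fin ℓ) → F g g' lt op t ≡ F g g' lt op t' → t ≡ t')
  × (∀ g g' lt op (t : Fin ℓ) →
         IsDiagonal (k * ℓ) (F g g' lt op t)
       × Connects k ℓ (F g g' lt op t) (toℕ g) (toℕ g')
       × MaximalIn k ℓ col (F g g' lt op t)
       × dist k ℓ (F g g' lt op t) ≥ dd k ℓ (suc (toℕ t)))

forcedCount : (k ℓ : ℕ) → {n : ℕ} → (Edge (k * ℓ) → Fin n) → ForcedFamily k ℓ → Fin n → ℕ
forcedCount k ℓ col F c =
  sumFin {k} (λ g → sumFin {k} (λ g' → pairCount g g' ((toℕ g <? toℕ g') ×-dec opposite? k (toℕ g) (toℕ g'))))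
  where
    pairCount : (g g' : Fin k) → Dec (toℕ g < toℕ g' × Opposite k (toℕ g) (toℕ g')) → ℕ
    pairCount g g' (yes (lt , op)) =
      sumFin {ℓ} (λ t → if isYes (col (F g g' lt op t) FinP.≟ c) then 1 else 0)
    pairCount g g' (no _) = 0

{-# OPTIONS --safe #-}
module Submission where

-- There are k pairs of opposite groups with ℓ forced edges each, so the kℓ = 2m + 1 forced
-- edges fall into m + 1 colour classes, and it suffices to show that no class holds three.
-- Let a chord own the dist(e) hull points of e⁻ together with one endpoint. Two non-crossing
-- chords owning a common point are comparable under ≤c, so the forced edges of one plane class,
-- being maximal, own disjoint sets and their distances add up to at most kℓ; each of them has
-- distance at least D = (a + 1)ℓ, and kℓ ≤ 3D. The 2m + 1 chords joining ⌊t/2⌋ and ⌈t/2⌉ + m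
-- pairwise cross unless t differs by one (cyclically), so every plane class contains one or two
-- of them, and every chord above one of them has distance at least m > D. In a class with three
-- forced edges such a chord h would either lie below one of them, pushing their distance sum
-- beyond 3D, or own points disjoint from all of them, giving 3D + m ≤ kℓ.

open import Defs
open import Data.Nat using (ℕ; _+_; _*_; _/_)
open import Data.Fin using (Fin)
open import Data.Product using (Σ; _×_)
open import Relation.Binary.PropositionalEquality using (_≡_; _≢_)

open import Data.Bool using (if_then_else_)
open import Data.Empty using (⊥; ⊥-elim)
open import Data.Unit using (tt)
open import Data.Fin using (toℕ; fromℕ<; punchIn) renaming (zero to fzero; suc to fsuc)
import Data.Fin.Properties as Fin
open import Data.Nat using (zero; suc; _∸_; _≤_; _<_; z≤n; s≤s; s≤s⁻¹; NonZero; ⌊_/2⌋; ⌈_/2⌉)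
open import Data.Nat.Properties
open import Data.Product using (_,_; proj₁; proj₂; ∃)
import Data.Product
open import Data.Sum using (_⊎_; inj₁; inj₂; [_,_])
import Data.Sum
open import Data.Vec.Functional using (removeAt)
open import Function using (_∘_)
open import Relation.Binary using (tri<; tri≈; tri>)
open import Relation.Binary.PropositionalEquality
  using (refl; sym; trans; cong; cong₂; subst; subst₂; module ≡-Reasoning)
open import Relation.Nullary using (¬_; Dec; yes; no)
open import Relation.Nullary.Decidable using (isYes; decidable-stable; ¬?; _×-dec_; _⊎-dec_; recompute)

import Algebra.Properties.Semiring.Sum +-*-semiring as Sum
open import Data.Nat.DivMod using (m*n/n≡m; /-mono-≤)
open import Data.Nat.Tactic.RingSolver using (solve-∀)

-- Indicators and sums over Fin

𝟙 : {P : Set} → Dec P → ℕ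
𝟙 d = if isYes d then 1 else 0

𝟙-yes : {P : Set} (d : Dec P) → P → 𝟙 d ≡ 1
𝟙-yes (yes _) _ = refl
𝟙-yes (no ¬p) p = ⊥-elim (¬p p)

𝟙-no : {P : Set} (d : Dec P) → ¬ P → 𝟙 d ≡ 0
𝟙-no (yes p) ¬p = ⊥-elim (¬p p)
𝟙-no (no _)  _  = refl

𝟙≤1 : {P : Set} (d : Dec P) → 𝟙 d ≤ 1
𝟙≤1 (yes _) = s≤s z≤n
𝟙≤1 (no _)  = z≤n

𝟙-witness : {P : Set} (d : Dec P) → 0 < 𝟙 d → P
𝟙-witness (yes p) _ = p

𝟙*-witness : {P : Set} (d : Dec P) (y : ℕ) → 0 < 𝟙 d * y → P × 0 < y
𝟙*-witness (yes p) y 0<y+0 = p , subst (0 <_) (+-identityʳ y) 0<y+0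

𝟙-cong : {P Q : Set} (d : Dec P) (e : Dec Q) → (P → Q) → (Q → P) → 𝟙 d ≡ 𝟙 e
𝟙-cong (yes p) e       p⇒q _   = sym (𝟙-yes e (p⇒q p))
𝟙-cong (no ¬p) e       _   q⇒p = sym (𝟙-no e (¬p ∘ q⇒p))

𝟙-⊎ : {P Q R : Set} (dp : Dec P) (dq : Dec Q) (dr : Dec R) →
      (P ⊎ Q → R) → (R → P ⊎ Q) → (P → ¬ Q) → 𝟙 dp + 𝟙 dq ≡ 𝟙 dr
𝟙-⊎ (yes p) (yes q) _  _  _  p⇒¬q = ⊥-elim (p⇒¬q p q)
𝟙-⊎ (yes p) (no _)  dr to _  _    = sym (𝟙-yes dr (to (inj₁ p)))
𝟙-⊎ (no _)  (yes q) dr to _  _    = sym (𝟙-yes dr (to (inj₂ q)))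
𝟙-⊎ (no ¬p) (no ¬q) dr _  fr _    = sym (𝟙-no dr ([ ¬p , ¬q ] ∘ fr))

recompute-< : ∀ {m n} → .(m < n) → m < n
recompute-< = recompute (_ <? _)

<⊎≥ : ∀ m n → m < n ⊎ n ≤ m
<⊎≥ m n with m <? n
... | yes m<n = inj₁ m<n
... | no m≮n  = inj₂ (≮⇒≥ m≮n)

sumFin≡sum : ∀ {m} (f : Fin m → ℕ) → sumFin f ≡ Sum.sum f
sumFin≡sum {zero}  f = refl
sumFin≡sum {suc m} f = cong (f fzero +_) (sumFin≡sum (f ∘ fsuc))

sumFin-cong : ∀ {m} {f g : Fin m → ℕ} → (∀ i → f i ≡ g i) → sumFin f ≡ sumFin g
sumFin-cong {zero}  f≗g = refl
sumFin-cong {suc m} f≗g = cong₂ _+_ (f≗g fzero) (sumFin-cong (f≗g ∘ fsuc))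

sumFin-mono : ∀ {m} {f g : Fin m → ℕ} → (∀ i → f i ≤ g i) → sumFin f ≤ sumFin g
sumFin-mono {zero}  f≤g = z≤n
sumFin-mono {suc m} f≤g = +-mono-≤ (f≤g fzero) (sumFin-mono (f≤g ∘ fsuc))

sumFin-const : ∀ m (c : ℕ) → sumFin {m} (λ _ → c) ≡ m * c
sumFin-const zero    c = refl
sumFin-const (suc m) c = cong (c +_) (sumFin-const m c)

sumFin-≡0 : ∀ {m} {f : Fin m → ℕ} → (∀ i → f i ≡ 0) → sumFin f ≡ 0
sumFin-≡0 {m} f≗0 = trans (sumFin-cong f≗0) (trans (sumFin-const m 0) (*-zeroʳ m))

sumFin-≤-const : ∀ {m} {f : Fin m → ℕ} (c : ℕ) → (∀ i → f i ≤ c) → sumFin f ≤ m * c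
sumFin-≤-const {m} c f≤c = subst (_ ≤_) (sumFin-const m c) (sumFin-mono f≤c)

sumFin-+ : ∀ {m} (f g : Fin m → ℕ) → sumFin (λ i → f i + g i) ≡ sumFin f + sumFin g
sumFin-+ f g = begin
  sumFin (λ i → f i + g i)   ≡⟨ sumFin≡sum (λ i → f i + g i) ⟩
  Sum.sum (λ i → f i + g i)  ≡⟨ Sum.∑-distrib-+ f g ⟩
  Sum.sum f + Sum.sum g      ≡⟨ cong₂ _+_ (sumFin≡sum f) (sumFin≡sum g) ⟨
  sumFin f + sumFin g        ∎
  where open ≡-Reasoning

sumFin-*ˡ : ∀ {m} (c : ℕ) (f : Fin m → ℕ) → sumFin (λ i → c * f i) ≡ c * sumFin f
sumFin-*ˡ c f = begin
  sumFin (λ i → c * f i)   ≡⟨ sumFin≡sum (λ i → c * f i) ⟩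
  Sum.sum (λ i → c * f i)  ≡⟨ Sum.*-distribˡ-sum c f ⟨
  c * Sum.sum f            ≡⟨ cong (c *_) (sumFin≡sum f) ⟨
  c * sumFin f             ∎
  where open ≡-Reasoning

sumFin-comm : ∀ {m p} (f : Fin m → Fin p → ℕ) →
              sumFin (λ i → sumFin (f i)) ≡ sumFin (λ j → sumFin (λ i → f i j))
sumFin-comm f = begin
  sumFin (λ i → sumFin (f i))               ≡⟨ sumFin²≡sum² f ⟩
  Sum.sum (λ i → Sum.sum (f i))             ≡⟨ Sum.∑-comm f ⟩
  Sum.sum (λ j → Sum.sum (λ i → f i j))     ≡⟨ sumFin²≡sum² (λ j i → f i j) ⟨
  sumFin (λ j → sumFin (λ i → f i j))       ∎
  where
  open ≡-Reasoning
  sumFin²≡sum² : ∀ {m p} (f : Fin m → Fin p → ℕ) →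
                 sumFin (λ i → sumFin (f i)) ≡ Sum.sum (λ i → Sum.sum (f i))
  sumFin²≡sum² f = trans (sumFin-cong (sumFin≡sum ∘ f)) (sumFin≡sum (λ i → Sum.sum (f i)))

sumFin-remove : ∀ {m} (f : Fin (suc m) → ℕ) (i : Fin (suc m)) →
                sumFin f ≡ f i + sumFin (f ∘ punchIn i)
sumFin-remove f i = begin
  sumFin f                      ≡⟨ sumFin≡sum f ⟩
  Sum.sum f                     ≡⟨ Sum.sum-remove f ⟩
  f i + Sum.sum (removeAt f i)  ≡⟨ cong (f i +_) (sumFin≡sum (f ∘ punchIn i)) ⟨
  f i + sumFin (f ∘ punchIn i)  ∎
  where open ≡-Reasoning

sumFin-term : ∀ {m} (f : Fin m → ℕ) (i : Fin m) → f i ≤ sumFin f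
sumFin-term f fzero    = m≤m+n _ _
sumFin-term f (fsuc i) = ≤-trans (sumFin-term (f ∘ fsuc) i) (m≤n+m _ (f fzero))

sumFin-witness : ∀ {m} (f : Fin m → ℕ) → 0 < sumFin f → ∃ λ i → 0 < f i
sumFin-witness {suc m} f 0<Σ with f fzero in eq
... | suc _ = fzero , subst (0 <_) (sym eq) (s≤s z≤n)
... | zero  with sumFin-witness (f ∘ fsuc) 0<Σ
...   | i , 0<fi = fsuc i , 0<fi

sumFin-≤1-unique : ∀ {m} (f : Fin m → ℕ) → (∀ i → f i ≤ 1) →
            (∀ i j → 0 < f i → 0 < f j → i ≡ j) → sumFin f ≤ 1
sumFin-≤1-unique {zero}  f f≤1 unique = z≤n
sumFin-≤1-unique {suc m} f f≤1 unique with Fin.any? (λ i → 0 <? f i)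
... | no ∄ = ≤-trans (≤-reflexive (sumFin-≡0 λ i → n≤0⇒n≡0 (≮⇒≥ (∄ ∘ (i ,_))))) z≤n
... | yes (i , 0<fi) = begin
  sumFin f                      ≡⟨ sumFin-remove f i ⟩
  f i + sumFin (f ∘ punchIn i)  ≡⟨ cong (f i +_) (sumFin-≡0 others0) ⟩
  f i + 0                       ≡⟨ +-identityʳ (f i) ⟩
  f i                           ≤⟨ f≤1 i ⟩
  1                             ∎
  where
  open ≤-Reasoning
  others0 : ∀ j → f (punchIn i j) ≡ 0
  others0 j = n≤0⇒n≡0 (≮⇒≥ λ 0<fj → Fin.punchInᵢ≢i i j (unique _ _ 0<fj 0<fi))

sumFin-≤2-no-three : ∀ {m} (f : Fin m → ℕ) → (∀ i → f i ≤ 1) →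
            (∀ i j l → toℕ i < toℕ j → toℕ j < toℕ l → 0 < f i → 0 < f j → 0 < f l → ⊥) →
            sumFin f ≤ 2
sumFin-≤2-no-three {zero}  f f≤1 no-three = z≤n
sumFin-≤2-no-three {suc m} f f≤1 no-three with f fzero in eq
... | zero = sumFin-≤2-no-three (f ∘ fsuc) (f≤1 ∘ fsuc) λ i j l i<j j<l →
               no-three (fsuc i) (fsuc j) (fsuc l) (s≤s i<j) (s≤s j<l)
... | suc zero = s≤s (sumFin-≤1-unique (f ∘ fsuc) (f≤1 ∘ fsuc) unique)
  where
  0<f0 : 0 < f fzero
  0<f0 = subst (0 <_) (sym eq) (s≤s z≤n)
  unique : ∀ i j → 0 < f (fsuc i) → 0 < f (fsuc j) → i ≡ j
  unique i j 0<fi 0<fj with Fin.<-cmp i j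
  ... | tri< i<j _ _ = ⊥-elim (no-three fzero (fsuc i) (fsuc j) (s≤s z≤n) (s≤s i<j) 0<f0 0<fi 0<fj)
  ... | tri≈ _ i≡j _ = i≡j
  ... | tri> _ _ j<i = ⊥-elim (no-three fzero (fsuc j) (fsuc i) (s≤s z≤n) (s≤s j<i) 0<f0 0<fj 0<fi)
... | suc (suc _) with subst (_≤ 1) eq (f≤1 fzero)
...   | s≤s ()

count-≡ : ∀ {m} (s : ℕ) → sumFin {m} (λ p → 𝟙 (toℕ p ≟ s)) ≡ 𝟙 (s <? m)
count-≡ {zero}  s       = sym (𝟙-no (s <? 0) λ ())
count-≡ {suc m} zero    = cong suc (sumFin-≡0 {m} λ p → 𝟙-no (suc (toℕ p) ≟ 0) λ ())
count-≡ {suc m} (suc s) = begin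
  sumFin {m} (λ p → 𝟙 (suc (toℕ p) ≟ suc s))
    ≡⟨ sumFin-cong {m} (λ p → 𝟙-cong (suc (toℕ p) ≟ suc s) (toℕ p ≟ s) suc-injective (cong suc)) ⟩
  sumFin {m} (λ p → 𝟙 (toℕ p ≟ s))            ≡⟨ count-≡ s ⟩
  𝟙 (s <? m)                                   ≡⟨ 𝟙-cong (s <? m) (suc s <? suc m) s≤s s≤s⁻¹ ⟩
  𝟙 (suc s <? suc m)                           ∎
  where open ≡-Reasoning

count-Fin≡ : ∀ {m} (x : Fin m) → sumFin (λ c → 𝟙 (x Fin.≟ c)) ≡ 1
count-Fin≡ x = trans (sumFin-cong λ c → 𝟙-cong (x Fin.≟ c) (toℕ c ≟ toℕ x) (cong toℕ ∘ sym) (sym ∘ Fin.toℕ-injective))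
                     (trans (count-≡ (toℕ x)) (𝟙-yes (toℕ x <? _) (Fin.toℕ<n x)))

count-fibres : ∀ {m n} (f : Fin m → Fin n) → sumFin (λ c → sumFin (λ t → 𝟙 (f t Fin.≟ c))) ≡ m
count-fibres {m} f = begin
  sumFin (λ c → sumFin (λ t → 𝟙 (f t Fin.≟ c)))  ≡⟨ sumFin-comm (λ c t → 𝟙 (f t Fin.≟ c)) ⟩
  sumFin (λ t → sumFin (λ c → 𝟙 (f t Fin.≟ c)))  ≡⟨ sumFin-cong (count-Fin≡ ∘ f) ⟩
  sumFin {m} (λ _ → 1)                             ≡⟨ sumFin-const m 1 ⟩
  m * 1                                            ≡⟨ *-identityʳ m ⟩
  m                                                ∎
  where open ≡-Reasoning

count-< : ∀ {m} (s : ℕ) → s ≤ m → sumFin {m} (λ p → 𝟙 (toℕ p <? s)) ≡ s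
count-< {m} zero _ = sumFin-≡0 {m} λ p → 𝟙-no (toℕ p <? 0) λ ()
count-< {suc m} (suc s) (s≤s s≤m) = cong₂ _+_ (𝟙-yes (0 <? suc s) (s≤s z≤n)) (begin
  sumFin {m} (λ p → 𝟙 (suc (toℕ p) <? suc s))
    ≡⟨ sumFin-cong {m} (λ p → 𝟙-cong (suc (toℕ p) <? suc s) (toℕ p <? s) s≤s⁻¹ s≤s) ⟩
  sumFin {m} (λ p → 𝟙 (toℕ p <? s))            ≡⟨ count-< s s≤m ⟩
  s                                             ∎)
  where open ≡-Reasoning

count-+< : ∀ m d → d ≤ m → sumFin {m} (λ p → 𝟙 (toℕ p + d <? m)) ≡ m ∸ d
count-+< m d d≤m = trans (sumFin-cong {m} λ p → 𝟙-cong (toℕ p + d <? m) (toℕ p <? m ∸ d)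
                                                  (m+n≤o⇒m≤o∸n (suc (toℕ p))) (m≤o∸n⇒m+n≤o (suc (toℕ p)) d≤m))
                         (count-< (m ∸ d) (m∸n≤m m d))

2*m≡m+m : ∀ m → 2 * m ≡ m + m
2*m≡m+m m = cong (m +_) (+-identityʳ m)

sumFin-≤-m+m : ∀ {m} (f : Fin m → ℕ) → (∀ i → f i ≤ 2) → sumFin f ≤ m + m
sumFin-≤-m+m {m} f f≤2 = subst (sumFin f ≤_) (trans (*-comm m 2) (2*m≡m+m m)) (sumFin-≤-const 2 f≤2)

sumFin-≤-m+m-with-zero : ∀ {m} (f : Fin (suc m) → ℕ) → (∀ i → f i ≤ 2) → ∀ i → f i ≡ 0 → sumFin f ≤ m + m
sumFin-≤-m+m-with-zero {m} f f≤2 i fi≡0 = begin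
  sumFin f                      ≡⟨ sumFin-remove f i ⟩
  f i + sumFin (f ∘ punchIn i)  ≡⟨ cong (_+ sumFin (f ∘ punchIn i)) fi≡0 ⟩
  sumFin (f ∘ punchIn i)        ≤⟨ sumFin-≤-m+m (f ∘ punchIn i) (f≤2 ∘ punchIn i) ⟩
  m + m                         ∎
  where open ≤-Reasoning

all-two : ∀ {m} (f : Fin m → ℕ) → (∀ i → f i ≤ 2) → sumFin f ≡ m + m → ∀ i → f i ≡ 2
all-two {suc m} f f≤2 Σ≡ i = ≤-antisym (f≤2 i) (+-cancelʳ-≤ (m + m) 2 (f i) (begin
  2 + (m + m)                   ≡⟨ cong suc (+-suc m m) ⟨
  suc m + suc m                 ≡⟨ Σ≡ ⟨
  sumFin f                      ≡⟨ sumFin-remove f i ⟩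
  f i + sumFin (f ∘ punchIn i)  ≤⟨ +-monoʳ-≤ (f i) (sumFin-≤-m+m (f ∘ punchIn i) (f≤2 ∘ punchIn i)) ⟩
  f i + (m + m)                 ∎))
  where open ≤-Reasoning

one-and-twos : ∀ {m} (f : Fin (suc m) → ℕ) → (∀ i → f i ≤ 2) → sumFin f ≡ suc (m + m) →
               Σ (Fin (suc m)) λ i → f i ≡ 1 × (∀ j → j ≢ i → f j ≡ 2)
one-and-twos {m} f f≤2 Σ≡ with Fin.any? (λ i → ¬? (f i ≟ 2))
... | no ∄ = ⊥-elim (even≢odd (suc m) m (begin
  2 * suc m               ≡⟨ *-comm 2 (suc m) ⟩
  suc m * 2               ≡⟨ sumFin-const (suc m) 2 ⟨
  sumFin {suc m} (λ _ → 2)  ≡⟨ sumFin-cong (λ i → decidable-stable (f i ≟ 2) (∄ ∘ (i ,_))) ⟨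
  sumFin f                ≡⟨ Σ≡ ⟩
  suc (m + m)             ≡⟨ cong suc (2*m≡m+m m) ⟨
  suc (2 * m)             ∎))
  where open ≡-Reasoning
... | yes (i , fi≢2) with f i in eq | sumFin-remove f i
...   | 0 | Σ≡0+rest = ⊥-elim (<-irrefl refl (begin-strict
  m + m                   <⟨ n<1+n (m + m) ⟩
  suc (m + m)             ≡⟨ trans (sym Σ≡) Σ≡0+rest ⟩
  sumFin (f ∘ punchIn i)  ≤⟨ sumFin-≤-m+m (f ∘ punchIn i) (f≤2 ∘ punchIn i) ⟩
  m + m                   ∎))
  where open ≤-Reasoning
...   | 1 | Σ≡1+rest = i , eq , λ j j≢i → subst (λ j → f j ≡ 2) (Fin.punchIn-punchOut (j≢i ∘ sym))
                                             (all-two (f ∘ punchIn i) (f≤2 ∘ punchIn i) rest≡ _)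
  where
  rest≡ : sumFin (f ∘ punchIn i) ≡ m + m
  rest≡ = suc-injective (trans (sym Σ≡1+rest) Σ≡)
...   | 2 | _ = ⊥-elim (fi≢2 refl)
...   | suc (suc (suc _)) | _ with subst (_≤ 2) eq (f≤2 i)
...     | s≤s (s≤s ())

-- Chords of the hull and the points they own

module Chords (k ℓ : ℕ) {{_ : NonZero ℓ}} where

  N : ℕ
  N = k * ℓ

  Short : ℕ → ℕ → Set
  Short = ShortInner k ℓ

  short? : ∀ a b → Dec (Short a b)
  short? a b = grp ℓ b ∸ grp ℓ a ≤? (k ∸ 1) / 2

  -- The points of ab⁻ together with the endpoint where the arc of ab⁻ starts (clockwise),
  -- so that a chord owns exactly dist of its points.
  Owns : ℕ → ℕ → ℕ → Set
  Owns a b p = (Short a b × a ≤ p × p < b) ⊎ (¬ Short a b × (p < a ⊎ b ≤ p))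

  owns? : ∀ a b p → Dec (Owns a b p)
  owns? a b p = (short? a b ×-dec (a ≤? p ×-dec p <? b)) ⊎-dec (¬? (short? a b) ×-dec (p <? a ⊎-dec b ≤? p))

  Below : ℕ → ℕ → ℕ → ℕ → Set
  Below a b c d = ClosedMinus k ℓ c d a × ClosedMinus k ℓ c d b

  Crosses : ℕ → ℕ → ℕ → ℕ → Set
  Crosses a b c d = (a < c × c < b × b < d) ⊎ (c < a × a < d × d < b)

  Nested : ℕ → ℕ → ℕ → ℕ → Set
  Nested a b c d = c ≤ a × b ≤ d

  closed-short : ∀ {a b x} → Short a b → a ≤ x → x ≤ b → ClosedMinus k ℓ a b x
  closed-short {a} {b} {x} s a≤x x≤b with m≤n⇒m<n∨m≡n a≤x | m≤n⇒m<n∨m≡n x≤b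
  ... | inj₂ a≡x | _         = inj₂ (inj₁ (sym a≡x))
  ... | inj₁ _   | inj₂ x≡b  = inj₂ (inj₂ x≡b)
  ... | inj₁ a<x | inj₁ x<b  = inj₁ (inj₁ (s , a<x , x<b))

  closed-left : ∀ {a b x} → ¬ Short a b → x ≤ a → ClosedMinus k ℓ a b x
  closed-left ¬s x≤a with m≤n⇒m<n∨m≡n x≤a
  ... | inj₁ x<a = inj₁ (inj₂ (¬s , inj₁ x<a))
  ... | inj₂ x≡a = inj₂ (inj₁ x≡a)

  closed-right : ∀ {a b x} → ¬ Short a b → b ≤ x → ClosedMinus k ℓ a b x
  closed-right ¬s b≤x with m≤n⇒m<n∨m≡n b≤x
  ... | inj₁ b<x = inj₁ (inj₂ (¬s , inj₂ b<x))
  ... | inj₂ b≡x = inj₂ (inj₂ (sym b≡x))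

  closed-short⁻¹ : ∀ {a b x} → Short a b → a < b → ClosedMinus k ℓ a b x → a ≤ x × x ≤ b
  closed-short⁻¹ s a<b (inj₁ (inj₁ (_ , a<x , x<b))) = <⇒≤ a<x , <⇒≤ x<b
  closed-short⁻¹ s a<b (inj₁ (inj₂ (¬s , _)))        = ⊥-elim (¬s s)
  closed-short⁻¹ s a<b (inj₂ (inj₁ refl))            = ≤-refl , <⇒≤ a<b
  closed-short⁻¹ s a<b (inj₂ (inj₂ refl))            = <⇒≤ a<b , ≤-refl

  closed-long⁻¹ : ∀ {a b x} → ¬ Short a b → ClosedMinus k ℓ a b x → x ≤ a ⊎ b ≤ x
  closed-long⁻¹ ¬s (inj₁ (inj₁ (s , _)))            = ⊥-elim (¬s s)
  closed-long⁻¹ ¬s (inj₁ (inj₂ (_ , inj₁ x<a)))     = inj₁ (<⇒≤ x<a)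
  closed-long⁻¹ ¬s (inj₁ (inj₂ (_ , inj₂ b<x)))     = inj₂ (<⇒≤ b<x)
  closed-long⁻¹ ¬s (inj₂ (inj₁ refl))               = inj₁ ≤-refl
  closed-long⁻¹ ¬s (inj₂ (inj₂ refl))               = inj₂ ≤-refl

  non-crossing-from-left : ∀ {a b c d} → a ≤ c → c < d → ¬ Crosses a b c d →
                           Nested c d a b ⊎ Nested a b c d ⊎ b ≤ c
  non-crossing-from-left {a} {b} {c} {d} a≤c c<d ¬cross with b ≤? c | d ≤? b | m≤n⇒m<n∨m≡n a≤c
  ... | yes b≤c | _       | _        = inj₂ (inj₂ b≤c)
  ... | no _    | yes d≤b | _        = inj₁ (a≤c , d≤b)
  ... | no b≰c  | no d≰b  | inj₂ a≡c = inj₂ (inj₁ (≤-reflexive (sym a≡c) , <⇒≤ (≰⇒> d≰b)))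
  ... | no b≰c  | no d≰b  | inj₁ a<c = ⊥-elim (¬cross (inj₁ (a<c , ≰⇒> b≰c , ≰⇒> d≰b)))

  non-crossing : ∀ {a b c d} → a < b → c < d → ¬ Crosses a b c d →
                 Nested c d a b ⊎ Nested a b c d ⊎ b ≤ c ⊎ d ≤ a
  non-crossing {a} {c = c} a<b c<d ¬cross with ≤-total a c
  ... | inj₁ a≤c = Data.Sum.map₂ (Data.Sum.map₂ inj₁) (non-crossing-from-left a≤c c<d ¬cross)
  ... | inj₂ c≤a with non-crossing-from-left c≤a a<b (¬cross ∘ Data.Sum.swap)
  ...   | inj₁ nested       = inj₂ (inj₁ nested)
  ...   | inj₂ (inj₁ nested) = inj₁ nested
  ...   | inj₂ (inj₂ d≤a)    = inj₂ (inj₂ (inj₂ d≤a))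

  nested-comparable : ∀ {a b c d p} → a < b → Nested a b c d → Owns a b p → Owns c d p →
                      Below a b c d ⊎ Below c d a b
  nested-comparable a<b (c≤a , b≤d) _ (inj₁ (s , _)) =
    inj₁ (closed-short s c≤a (≤-trans (<⇒≤ a<b) b≤d) , closed-short s (≤-trans c≤a (<⇒≤ a<b)) b≤d)
  nested-comparable a<b (c≤a , b≤d) (inj₁ (_ , a≤p , p<b)) (inj₂ (_ , inj₁ p<c)) =
    ⊥-elim (<-irrefl refl (<-≤-trans p<c (≤-trans c≤a a≤p)))
  nested-comparable a<b (c≤a , b≤d) (inj₁ (_ , a≤p , p<b)) (inj₂ (_ , inj₂ d≤p)) =
    ⊥-elim (<-irrefl refl (<-≤-trans p<b (≤-trans b≤d d≤p)))
  nested-comparable a<b (c≤a , b≤d) (inj₂ (¬s , _)) (inj₂ _) =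
    inj₂ (closed-left ¬s c≤a , closed-right ¬s b≤d)

  separated-comparable : ∀ {a b c d p} → a < b → c < d → b ≤ c → Owns a b p → Owns c d p →
                         Below a b c d ⊎ Below c d a b
  separated-comparable a<b c<d b≤c _ (inj₂ (¬s , _)) =
    inj₁ (closed-left ¬s (≤-trans (<⇒≤ a<b) b≤c) , closed-left ¬s b≤c)
  separated-comparable a<b c<d b≤c (inj₂ (¬s , _)) (inj₁ _) =
    inj₂ (closed-right ¬s b≤c , closed-right ¬s (≤-trans b≤c (<⇒≤ c<d)))
  separated-comparable a<b c<d b≤c (inj₁ (_ , _ , p<b)) (inj₁ (_ , c≤p , _)) =
    ⊥-elim (<-irrefl refl (<-≤-trans p<b (≤-trans b≤c c≤p)))

  owners-comparable : ∀ {a b c d p} → a < b → c < d → ¬ Crosses a b c d → Owns a b p → Owns c d p →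
                      Below a b c d ⊎ Below c d a b
  owners-comparable a<b c<d ¬cross own₁ own₂ with non-crossing a<b c<d ¬cross
  ... | inj₁ nested               = Data.Sum.swap (nested-comparable c<d nested own₂ own₁)
  ... | inj₂ (inj₁ nested)        = nested-comparable a<b nested own₁ own₂
  ... | inj₂ (inj₂ (inj₁ b≤c))    = separated-comparable a<b c<d b≤c own₁ own₂
  ... | inj₂ (inj₂ (inj₂ d≤a))    = Data.Sum.swap (separated-comparable c<d a<b d≤a own₂ own₁)

  owns-split-short : ∀ {a b} → Short a b → a < b → ∀ p →
                     𝟙 (inMinus? k ℓ a b p) + 𝟙 (p ≟ a) ≡ 𝟙 (owns? a b p)
  owns-split-short {a} {b} s a<b p = 𝟙-⊎ (inMinus? k ℓ a b p) (p ≟ a) (owns? a b p) to from disjoint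
    where
    to : InMinus k ℓ a b p ⊎ p ≡ a → Owns a b p
    to (inj₁ (inj₁ (_ , a<p , p<b))) = inj₁ (s , <⇒≤ a<p , p<b)
    to (inj₁ (inj₂ (¬s , _)))        = ⊥-elim (¬s s)
    to (inj₂ refl)                   = inj₁ (s , ≤-refl , a<b)
    from : Owns a b p → InMinus k ℓ a b p ⊎ p ≡ a
    from (inj₁ (_ , a≤p , p<b)) with m≤n⇒m<n∨m≡n a≤p
    ... | inj₁ a<p = inj₁ (inj₁ (s , a<p , p<b))
    ... | inj₂ a≡p = inj₂ (sym a≡p)
    from (inj₂ (¬s , _)) = ⊥-elim (¬s s)
    disjoint : InMinus k ℓ a b p → ¬ p ≡ a
    disjoint (inj₁ (_ , a<p , _)) p≡a = <-irrefl (sym p≡a) a<p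
    disjoint (inj₂ (¬s , _))      _   = ¬s s

  owns-split-long : ∀ {a b} → ¬ Short a b → a < b → ∀ p →
                    𝟙 (inMinus? k ℓ a b p) + 𝟙 (p ≟ b) ≡ 𝟙 (owns? a b p)
  owns-split-long {a} {b} ¬s a<b p = 𝟙-⊎ (inMinus? k ℓ a b p) (p ≟ b) (owns? a b p) to from disjoint
    where
    to : InMinus k ℓ a b p ⊎ p ≡ b → Owns a b p
    to (inj₁ (inj₁ (s , _)))             = ⊥-elim (¬s s)
    to (inj₁ (inj₂ (_ , inj₁ p<a)))      = inj₂ (¬s , inj₁ p<a)
    to (inj₁ (inj₂ (_ , inj₂ b<p)))      = inj₂ (¬s , inj₂ (<⇒≤ b<p))
    to (inj₂ refl)                       = inj₂ (¬s , inj₂ ≤-refl)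
    from : Owns a b p → InMinus k ℓ a b p ⊎ p ≡ b
    from (inj₁ (s , _))            = ⊥-elim (¬s s)
    from (inj₂ (_ , inj₁ p<a))     = inj₁ (inj₂ (¬s , inj₁ p<a))
    from (inj₂ (_ , inj₂ b≤p)) with m≤n⇒m<n∨m≡n b≤p
    ... | inj₁ b<p = inj₁ (inj₂ (¬s , inj₂ b<p))
    ... | inj₂ b≡p = inj₂ (sym b≡p)
    disjoint : InMinus k ℓ a b p → ¬ p ≡ b
    disjoint (inj₁ (s , _))             _   = ¬s s
    disjoint (inj₂ (_ , inj₁ p<a))      p≡b = <-asym a<b (subst (_< a) p≡b p<a)
    disjoint (inj₂ (_ , inj₂ b<p))      p≡b = <-irrefl (sym p≡b) b<p

  owns : Edge N → Fin N → ℕ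
  owns (radial _)    p = 0
  owns (chord a b _) p = 𝟙 (owns? (toℕ a) (toℕ b) (toℕ p))

  sum-owns-split : ∀ (a b : Fin N) .(a<b : toℕ a < toℕ b) (s : Fin N) →
               (∀ p → 𝟙 (inMinus? k ℓ (toℕ a) (toℕ b) (toℕ p)) + 𝟙 (toℕ p ≟ toℕ s) ≡ owns (chord a b a<b) p) →
               sumFin (owns (chord a b a<b)) ≡ dist k ℓ (chord a b a<b)
  sum-owns-split a b a<b s split = begin
    sumFin (owns (chord a b a<b))                                                   ≡⟨ sumFin-cong split ⟨
    sumFin {N} (λ p → 𝟙 (inMinus? k ℓ (toℕ a) (toℕ b) (toℕ p)) + 𝟙 (toℕ p ≟ toℕ s))
      ≡⟨ sumFin-+ {N} (λ p → 𝟙 (inMinus? k ℓ (toℕ a) (toℕ b) (toℕ p))) (λ p → 𝟙 (toℕ p ≟ toℕ s)) ⟩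
    InMinusCount + sumFin (λ (p : Fin N) → 𝟙 (toℕ p ≟ toℕ s))
      ≡⟨ cong (InMinusCount +_) (trans (count-≡ (toℕ s)) (𝟙-yes (toℕ s <? N) (Fin.toℕ<n s))) ⟩
    InMinusCount + 1                                                                 ≡⟨ +-comm InMinusCount 1 ⟩
    dist k ℓ (chord a b a<b)                                                         ∎
    where
    open ≡-Reasoning
    InMinusCount : ℕ
    InMinusCount = sumFin (λ (p : Fin N) → 𝟙 (inMinus? k ℓ (toℕ a) (toℕ b) (toℕ p)))

  sum-owns : ∀ e → sumFin (owns e) ≡ dist k ℓ e
  sum-owns (radial _)      = sumFin-≡0 {N} (λ _ → refl)
  sum-owns (chord a b a<b) = by-orientation (short? (toℕ a) (toℕ b))
    where
    by-orientation : Dec (Short (toℕ a) (toℕ b)) → sumFin (owns (chord a b a<b)) ≡ dist k ℓ (chord a b a<b)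
    by-orientation (yes s) = sum-owns-split a b a<b a (owns-split-short s (recompute-< a<b) ∘ toℕ)
    by-orientation (no ¬s) = sum-owns-split a b a<b b (owns-split-long ¬s (recompute-< a<b) ∘ toℕ)

  dist-short : ∀ (a b : Fin N) .(a<b : toℕ a < toℕ b) → Short (toℕ a) (toℕ b) →
               toℕ a + dist k ℓ (chord a b a<b) ≡ toℕ b
  dist-short a b a<b s = begin
    toℕ a + dist k ℓ (chord a b a<b)
      ≡⟨ cong₂ _+_ (count-< (toℕ a) (<⇒≤ (Fin.toℕ<n a))) (sum-owns (chord a b a<b)) ⟨
    sumFin {N} (λ p → 𝟙 (toℕ p <? toℕ a)) + sumFin (owns (chord a b a<b))  ≡⟨ sumFin-+ {N} _ _ ⟨
    sumFin {N} (λ p → 𝟙 (toℕ p <? toℕ a) + owns (chord a b a<b) p)         ≡⟨ sumFin-cong {N} (before-b ∘ toℕ) ⟩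
    sumFin {N} (λ p → 𝟙 (toℕ p <? toℕ b))                                 ≡⟨ count-< (toℕ b) (<⇒≤ (Fin.toℕ<n b)) ⟩
    toℕ b                                                                  ∎
    where
    open ≡-Reasoning
    before-b : ∀ p → 𝟙 (p <? toℕ a) + 𝟙 (owns? (toℕ a) (toℕ b) p) ≡ 𝟙 (p <? toℕ b)
    before-b p = 𝟙-⊎ (p <? toℕ a) (owns? (toℕ a) (toℕ b) p) (p <? toℕ b)
      [ (λ p<a → <-trans p<a (recompute-< a<b)) , (λ { (inj₁ (_ , _ , p<b)) → p<b ; (inj₂ (¬s , _)) → ⊥-elim (¬s s) }) ]
      (λ p<b → Data.Sum.map₂ (λ a≤p → inj₁ (s , a≤p , p<b)) (<⊎≥ p (toℕ a)))
      λ { p<a (inj₁ (_ , a≤p , _)) → <⇒≱ p<a a≤p ; _ (inj₂ (¬s , _)) → ¬s s }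

  dist-long : ∀ (a b : Fin N) .(a<b : toℕ a < toℕ b) → ¬ Short (toℕ a) (toℕ b) →
              dist k ℓ (chord a b a<b) + toℕ b ≡ N + toℕ a
  dist-long a b a<b ¬s = begin
    dist k ℓ (chord a b a<b) + toℕ b                                 ≡⟨ cong (_+ toℕ b) (sum-owns (chord a b a<b)) ⟨
    sumFin (owns (chord a b a<b)) + toℕ b
      ≡⟨ cong (_+ toℕ b) (sumFin-cong {N} (outside ∘ toℕ)) ⟨
    sumFin {N} (λ p → 𝟙 (toℕ p <? toℕ a) + 𝟙 (toℕ b ≤? toℕ p)) + toℕ b
      ≡⟨ cong₂ _+_ (trans (sumFin-+ {N} _ _) (cong (_+ AfterB) (count-< (toℕ a) (<⇒≤ (Fin.toℕ<n a)))))
                   (sym (count-< (toℕ b) (<⇒≤ (Fin.toℕ<n b)))) ⟩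
    (toℕ a + AfterB) + sumFin {N} (λ p → 𝟙 (toℕ p <? toℕ b))          ≡⟨ +-assoc (toℕ a) AfterB _ ⟩
    toℕ a + (AfterB + sumFin {N} (λ p → 𝟙 (toℕ p <? toℕ b)))          ≡⟨ cong (toℕ a +_) (sumFin-+ {N} _ _) ⟨
    toℕ a + sumFin {N} (λ p → 𝟙 (toℕ b ≤? toℕ p) + 𝟙 (toℕ p <? toℕ b))
      ≡⟨ cong (toℕ a +_) (sumFin-cong {N} (complement ∘ toℕ)) ⟩
    toℕ a + sumFin {N} (λ _ → 1)
      ≡⟨ cong (toℕ a +_) (trans (sumFin-const N 1) (*-identityʳ N)) ⟩
    toℕ a + N                                                        ≡⟨ +-comm (toℕ a) N ⟩
    N + toℕ a                                                        ∎
    where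
    open ≡-Reasoning
    AfterB : ℕ
    AfterB = sumFin {N} (λ p → 𝟙 (toℕ b ≤? toℕ p))
    outside : ∀ p → 𝟙 (p <? toℕ a) + 𝟙 (toℕ b ≤? p) ≡ 𝟙 (owns? (toℕ a) (toℕ b) p)
    outside p = 𝟙-⊎ (p <? toℕ a) (toℕ b ≤? p) (owns? (toℕ a) (toℕ b) p)
      (λ out → inj₂ (¬s , out))
      (λ { (inj₁ (s , _)) → ⊥-elim (¬s s) ; (inj₂ (_ , out)) → out })
      (λ p<a b≤p → <⇒≱ (<-trans p<a (recompute-< a<b)) b≤p)
    complement : ∀ p → 𝟙 (toℕ b ≤? p) + 𝟙 (p <? toℕ b) ≡ 1
    complement p = 𝟙-⊎ (toℕ b ≤? p) (p <? toℕ b) (yes tt) (λ _ → tt) (λ _ → Data.Sum.swap (<⊎≥ p (toℕ b))) ≤⇒≯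

  owns≤1 : ∀ e p → owns e p ≤ 1
  owns≤1 (radial _)    p = z≤n
  owns≤1 (chord a b _) p = 𝟙≤1 (owns? _ _ _)

  infix 4 _≤c_ _≤c?_

  _≤c_ : Edge N → Edge N → Set
  chord a b _ ≤c chord c d _ = Below (toℕ a) (toℕ b) (toℕ c) (toℕ d)
  _           ≤c _           = ⊥

  closedMinus? : ∀ c d x → Dec (ClosedMinus k ℓ c d x)
  closedMinus? c d x = inMinus? k ℓ c d x ⊎-dec (x ≟ c ⊎-dec x ≟ d)

  _≤c?_ : ∀ e f → Dec (e ≤c f)
  chord a b _ ≤c? chord c d _ = closedMinus? (toℕ c) (toℕ d) (toℕ a) ×-dec closedMinus? (toℕ c) (toℕ d) (toℕ b)
  radial _    ≤c? _           = no λ ()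
  chord _ _ _ ≤c? radial _    = no λ ()

  ≤c-refl : ∀ a b .(a<b : toℕ a < toℕ b) → chord a b a<b ≤c chord a b a<b
  ≤c-refl a b _ = inj₂ (inj₁ refl) , inj₂ (inj₂ refl)

  owner-≤c-refl : ∀ e p → 0 < owns e p → e ≤c e
  owner-≤c-refl (chord a b a<b) p _ = ≤c-refl a b a<b

  ≤c⇒≡⊎<c : ∀ {e f} → e ≤c f → e ≡ f ⊎ LtC k ℓ e f
  ≤c⇒≡⊎<c {chord a b _} {chord c d _} (a∈ , b∈) with a Fin.≟ c | b Fin.≟ d
  ... | yes refl | yes refl = inj₁ refl
  ... | no a≢c   | _        = inj₂ (a∈ , b∈ , a≢c ∘ proj₁)
  ... | yes _    | no b≢d   = inj₂ (a∈ , b∈ , b≢d ∘ proj₂)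

  maximal-≤c : ∀ {n} {col : Edge N → Fin n} {e f} → MaximalIn k ℓ col e → col f ≡ col e → e ≤c f → e ≡ f
  maximal-≤c {f = f} maximal same-colour e≤f with ≤c⇒≡⊎<c e≤f
  ... | inj₁ e≡f = e≡f
  ... | inj₂ e<f = ⊥-elim (maximal f same-colour e<f)

  owners-≤c : ∀ {e f} p → ¬ Cross k ℓ e f → 0 < owns e p → 0 < owns f p → e ≤c f ⊎ f ≤c e
  owners-≤c {chord a b a<b} {chord c d c<d} p ¬cross owns₁ owns₂ =
    owners-comparable (recompute-< a<b) (recompute-< c<d) ¬cross
                      (𝟙-witness (owns? _ _ _) owns₁) (𝟙-witness (owns? _ _ _) owns₂)

  connects-unique : ∀ e {g g' h h'} → g < g' → h < h' → Connects k ℓ e g g' → Connects k ℓ e h h' → g ≡ h × g' ≡ h'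
  connects-unique (chord x y x<y) g<g' h<h' = unique
    where
    grp-mono : grp ℓ (toℕ x) ≤ grp ℓ (toℕ y)
    grp-mono = /-mono-≤ (<⇒≤ (recompute-< x<y)) (≤-refl {ℓ})
    unique : _ → _ → _
    unique (inj₁ (x∈g , y∈g')) (inj₁ (x∈h , y∈h')) = trans (sym x∈g) x∈h , trans (sym y∈g') y∈h'
    unique (inj₁ _)            (inj₂ (x∈h' , y∈h)) = ⊥-elim (<⇒≱ h<h' (subst₂ _≤_ x∈h' y∈h grp-mono))
    unique (inj₂ (x∈g' , y∈g)) _                   = ⊥-elim (<⇒≱ g<g' (subst₂ _≤_ x∈g' y∈g grp-mono))

-- Near-halving chords

⌈n/2⌉≤1+⌊n/2⌋ : ∀ n → ⌈ n /2⌉ ≤ suc ⌊ n /2⌋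
⌈n/2⌉≤1+⌊n/2⌋ zero          = z≤n
⌈n/2⌉≤1+⌊n/2⌋ (suc zero)    = s≤s z≤n
⌈n/2⌉≤1+⌊n/2⌋ (suc (suc n)) = s≤s (⌈n/2⌉≤1+⌊n/2⌋ n)

⌈n/2⌉≤0⇒n≡0 : ∀ {n} → ⌈ n /2⌉ ≤ 0 → n ≡ 0
⌈n/2⌉≤0⇒n≡0 {zero} _ = refl

m≤⌊n/2⌋⇒m+m≤n : ∀ {m} n → m ≤ ⌊ n /2⌋ → m + m ≤ n
m≤⌊n/2⌋⇒m+m≤n n m≤⌊n/2⌋ =
  subst (_ ≤_) (⌊n/2⌋+⌈n/2⌉≡n n) (+-mono-≤ m≤⌊n/2⌋ (≤-trans m≤⌊n/2⌋ (⌊n/2⌋≤⌈n/2⌉ n)))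

module Halving (k ℓ : ℕ) {{_ : NonZero ℓ}} (m : ℕ) (N≡ : k * ℓ ≡ suc (m + m)) (2≤m : 2 ≤ m) where
  open Chords k ℓ

  below-short-dist : ∀ {x y} (a b : Fin N) .(a<b : toℕ a < toℕ b) → Short (toℕ a) (toℕ b) →
                     x + m ≤ y → Below x y (toℕ a) (toℕ b) → m ≤ dist k ℓ (chord a b a<b)
  below-short-dist {x} {y} a b a<b s x+m≤y (x∈ , y∈) = +-cancelˡ-≤ (toℕ a) m _ (begin
    toℕ a + m                         ≤⟨ +-monoˡ-≤ m (proj₁ (closed-short⁻¹ s (recompute-< a<b) x∈)) ⟩
    x + m                             ≤⟨ x+m≤y ⟩
    y                                 ≤⟨ proj₂ (closed-short⁻¹ s (recompute-< a<b) y∈) ⟩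
    toℕ b                             ≡⟨ dist-short a b a<b s ⟨
    toℕ a + dist k ℓ (chord a b a<b)  ∎)
    where open ≤-Reasoning

  below-long-dist : ∀ {x y} (a b : Fin N) .(a<b : toℕ a < toℕ b) → ¬ Short (toℕ a) (toℕ b) →
                    x + m ≤ y → y ≤ suc (x + m) → y < N → Below x y (toℕ a) (toℕ b) → m ≤ dist k ℓ (chord a b a<b)
  below-long-dist {x} {y} a b a<b ¬s x+m≤y y≤x+m+1 y<N (x∈ , y∈) =
    +-cancelʳ-≤ B m _ (≤-trans (sides (closed-long⁻¹ ¬s x∈) (closed-long⁻¹ ¬s y∈))
                               (≤-reflexive (sym (dist-long a b a<b ¬s))))
    where
    open ≤-Reasoning
    A B : ℕ
    A = toℕ a
    B = toℕ b
    sides : x ≤ A ⊎ B ≤ x → y ≤ A ⊎ B ≤ y → m + B ≤ N + A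
    sides (inj₁ x≤A) (inj₁ y≤A) = begin
      m + B  ≤⟨ +-mono-≤ (≤-trans (m≤n+m m x) (≤-trans x+m≤y y≤A)) (<⇒≤ (Fin.toℕ<n b)) ⟩
      A + N  ≡⟨ +-comm A N ⟩
      N + A  ∎
    sides (inj₂ B≤x) (inj₂ _) = begin
      m + B  ≤⟨ +-monoʳ-≤ m B≤x ⟩
      m + x  ≡⟨ +-comm m x ⟩
      x + m  ≤⟨ ≤-trans x+m≤y (<⇒≤ y<N) ⟩
      N      ≤⟨ m≤m+n N A ⟩
      N + A  ∎
    sides (inj₁ x≤A) (inj₂ B≤y) = begin
      m + B              ≤⟨ +-monoʳ-≤ m (≤-trans B≤y y≤x+m+1) ⟩
      m + suc (x + m)    ≡⟨ +-suc m (x + m) ⟩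
      suc (m + (x + m))  ≡⟨ cong suc (trans (cong (m +_) (+-comm x m)) (sym (+-assoc m m x))) ⟩
      suc (m + m) + x    ≡⟨ cong (_+ x) N≡ ⟨
      N + x              ≤⟨ +-monoʳ-≤ N x≤A ⟩
      N + A              ∎
    sides (inj₂ B≤x) (inj₁ y≤A) =
      ⊥-elim (<⇒≱ (recompute-< a<b) (≤-trans B≤x (≤-trans (m≤m+n x m) (≤-trans x+m≤y y≤A))))

  lower upper : ℕ → ℕ
  lower t = ⌊ t /2⌋
  upper t = ⌈ t /2⌉ + m

  HalvingCross : ℕ → ℕ → Set
  HalvingCross t t' = Crosses (lower t) (upper t) (lower t') (upper t')

  index≤2m : (t : Fin N) → toℕ t ≤ m + m
  index≤2m t = s≤s⁻¹ (subst (toℕ t <_) N≡ (Fin.toℕ<n t))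

  lower≤m : ∀ {t} → t ≤ m + m → lower t ≤ m
  lower≤m {t} t≤2m = subst (lower t ≤_) (sym (n≡⌊n+n/2⌋ m)) (⌊n/2⌋-mono t≤2m)

  upper<N : (t : Fin N) → upper (toℕ t) < N
  upper<N t = subst (upper (toℕ t) <_) (sym N≡)
    (s≤s (+-monoˡ-≤ m (subst (⌈ toℕ t /2⌉ ≤_) (sym (n≡⌈n+n/2⌉ m)) (⌈n/2⌉-mono (index≤2m t)))))

  lower<upper : ∀ t → lower t < upper t
  lower<upper t = ≤-<-trans (⌊n/2⌋≤⌈n/2⌉ t) (m<m+n ⌈ t /2⌉ (≤-trans (s≤s z≤n) 2≤m))

  lowerEnd upperEnd : Fin N → Fin N
  lowerEnd t = fromℕ< (<-trans (lower<upper (toℕ t)) (upper<N t))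
  upperEnd t = fromℕ< (upper<N t)

  toℕ-lowerEnd : ∀ t → toℕ (lowerEnd t) ≡ lower (toℕ t)
  toℕ-lowerEnd t = Fin.toℕ-fromℕ< _

  toℕ-upperEnd : ∀ t → toℕ (upperEnd t) ≡ upper (toℕ t)
  toℕ-upperEnd t = Fin.toℕ-fromℕ< _

  lowerEnd<upperEnd : ∀ t → toℕ (lowerEnd t) < toℕ (upperEnd t)
  lowerEnd<upperEnd t = subst₂ _<_ (sym (toℕ-lowerEnd t)) (sym (toℕ-upperEnd t)) (lower<upper (toℕ t))

  -- Chord t joins ⌊t/2⌋ to ⌈t/2⌉ + m, leaving m − 1 and m of the other hull points on its sides.
  halving : Fin N → Edge N
  halving t = chord (lowerEnd t) (upperEnd t) (lowerEnd<upperEnd t)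

  halving-≤c⇒dist : ∀ t e → halving t ≤c e → m ≤ dist k ℓ e
  halving-≤c⇒dist t (chord a b a<b) below = by-orientation (short? (toℕ a) (toℕ b))
    where
    spread₁ : toℕ (lowerEnd t) + m ≤ toℕ (upperEnd t)
    spread₁ rewrite toℕ-lowerEnd t | toℕ-upperEnd t = +-monoˡ-≤ m (⌊n/2⌋≤⌈n/2⌉ (toℕ t))
    spread₂ : toℕ (upperEnd t) ≤ suc (toℕ (lowerEnd t) + m)
    spread₂ rewrite toℕ-lowerEnd t | toℕ-upperEnd t = +-monoˡ-≤ m (⌈n/2⌉≤1+⌊n/2⌋ (toℕ t))
    by-orientation : Dec (Short (toℕ a) (toℕ b)) → m ≤ dist k ℓ (chord a b a<b)
    by-orientation (yes s) = below-short-dist a b a<b s spread₁ below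
    by-orientation (no ¬s) = below-long-dist a b a<b ¬s spread₁ spread₂ (Fin.toℕ<n (upperEnd t)) below

  dist-halving : ∀ t → m ≤ dist k ℓ (halving t)
  dist-halving t = halving-≤c⇒dist t (halving t) (≤c-refl (lowerEnd t) (upperEnd t) (lowerEnd<upperEnd t))

  halving-crossing : ∀ i j → HalvingCross (toℕ i) (toℕ j) → Cross k ℓ (halving i) (halving j)
  halving-crossing i j rewrite toℕ-lowerEnd i | toℕ-upperEnd i | toℕ-lowerEnd j | toℕ-upperEnd j = λ cross → cross

  halving-non-crossing : ∀ {t t'} → t < t' → t' ≤ m + m → ¬ HalvingCross t t' →
                         t' ≡ suc t ⊎ (t ≡ 0 × t' ≡ m + m)
  halving-non-crossing {t} {t'} t<t' t'≤2m ¬cross with t' ≟ suc t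
  ... | yes t'≡1+t = inj₁ t'≡1+t
  ... | no t'≢1+t with lower t' <? upper t
  ...   | yes l'<u = ⊥-elim (¬cross (inj₁ (⌊n/2⌋-mono 2+t≤t' , l'<u , +-monoˡ-≤ m (⌈n/2⌉-mono 2+t≤t'))))
    where
    2+t≤t' : suc (suc t) ≤ t'
    2+t≤t' = ≤∧≢⇒< t<t' (t'≢1+t ∘ sym)
  ...   | no l'≮u = inj₂ (⌈n/2⌉≤0⇒n≡0 (+-cancelʳ-≤ m ⌈ t /2⌉ 0 (≤-trans u≤l' (lower≤m t'≤2m))) ,
                          ≤-antisym t'≤2m (m≤⌊n/2⌋⇒m+m≤n t' (≤-trans (m≤n+m m ⌈ t /2⌉) u≤l')))
    where
    u≤l' : upper t ≤ lower t'
    u≤l' = ≮⇒≥ l'≮u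

  no-three-non-crossing : ∀ {t₁ t₂ t₃} → t₁ < t₂ → t₂ < t₃ → t₃ ≤ m + m →
                          ¬ HalvingCross t₁ t₂ → ¬ HalvingCross t₂ t₃ → ¬ HalvingCross t₁ t₃ → ⊥
  no-three-non-crossing {t₁} {t₂} {t₃} t₁<t₂ t₂<t₃ t₃≤2m ¬c₁₂ ¬c₂₃ ¬c₁₃
    with halving-non-crossing t₁<t₂ (≤-trans (<⇒≤ t₂<t₃) t₃≤2m) ¬c₁₂
       | halving-non-crossing t₂<t₃ t₃≤2m ¬c₂₃
       | halving-non-crossing (<-trans t₁<t₂ t₂<t₃) t₃≤2m ¬c₁₃
  ... | _            | _             | inj₁ t₃≡1+t₁       = <⇒≱ t₁<t₂ (s≤s⁻¹ (subst (t₂ <_) t₃≡1+t₁ t₂<t₃))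
  ... | _            | inj₂ (t₂≡0 , _) | inj₂ _           = <⇒≱ t₁<t₂ (≤-trans (≤-reflexive t₂≡0) z≤n)
  ... | inj₂ (_ , t₂≡2m) | inj₁ _    | inj₂ (_ , t₃≡2m) = <-irrefl (trans t₂≡2m (sym t₃≡2m)) t₂<t₃
  ... | inj₁ t₂≡1+t₁ | inj₁ t₃≡1+t₂  | inj₂ (t₁≡0 , t₃≡2m) = <-irrefl refl (begin-strict
    m + m  ≡⟨ trans (sym t₃≡2m) (trans t₃≡1+t₂ (cong suc (trans t₂≡1+t₁ (cong suc t₁≡0)))) ⟩
    2      <⟨ s≤s (s≤s (s≤s z≤n)) ⟩
    4      ≤⟨ +-mono-≤ 2≤m 2≤m ⟩
    m + m  ∎)
    where open ≤-Reasoning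

  halving-colour-count≤2 : ∀ {n} (col : Edge N → Fin n) → AllPlane k ℓ col →
                           ∀ c → sumFin (λ t → 𝟙 (col (halving t) Fin.≟ c)) ≤ 2
  halving-colour-count≤2 col plane c = sumFin-≤2-no-three _ (λ t → 𝟙≤1 (col (halving t) Fin.≟ c)) no-three
    where
    ¬cross : ∀ i j → 0 < 𝟙 (col (halving i) Fin.≟ c) → 0 < 𝟙 (col (halving j) Fin.≟ c) →
             ¬ HalvingCross (toℕ i) (toℕ j)
    ¬cross i j cᵢ cⱼ = plane (halving i) (halving j)
                         (trans (𝟙-witness (_ Fin.≟ c) cᵢ) (sym (𝟙-witness (_ Fin.≟ c) cⱼ)))
                     ∘ halving-crossing i j
    no-three : ∀ i j l → toℕ i < toℕ j → toℕ j < toℕ l → 0 < 𝟙 (col (halving i) Fin.≟ c) →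
               0 < 𝟙 (col (halving j) Fin.≟ c) → 0 < 𝟙 (col (halving l) Fin.≟ c) → ⊥
    no-three i j l i<j j<l cᵢ cⱼ cₗ =
      no-three-non-crossing i<j j<l (index≤2m l) (¬cross i j cᵢ cⱼ) (¬cross j l cⱼ cₗ) (¬cross i l cᵢ cₗ)

  module _ (col : Edge N → Fin (suc m)) (plane : AllPlane k ℓ col) where

    halvingCount : Fin (suc m) → ℕ
    halvingCount c = sumFin (λ t → 𝟙 (col (halving t) Fin.≟ c))

    halving-in-every-class : ∀ c → ∃ λ t → col (halving t) ≡ c
    halving-in-every-class c with 0 <? halvingCount c
    ... | yes 0<count = Data.Product.map₂ (𝟙-witness (col _ Fin.≟ c)) (sumFin-witness _ 0<count)
    ... | no ¬0<count = ⊥-elim (<-irrefl refl (begin-strict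
      m + m                 <⟨ n<1+n (m + m) ⟩
      suc (m + m)           ≡⟨ N≡ ⟨
      N                     ≡⟨ count-fibres (col ∘ halving) ⟨
      sumFin halvingCount
        ≤⟨ sumFin-≤-m+m-with-zero halvingCount (halving-colour-count≤2 col plane) c (n≤0⇒n≡0 (≮⇒≥ ¬0<count)) ⟩
      m + m                 ∎))
      where open ≤-Reasoning

-- Sums over the forced family

restrict : {P : Set} → Dec P → (P → ℕ) → ℕ
restrict (yes p) f = f p
restrict (no _)  _ = 0

restrict-lift : (R : ℕ → ℕ → Set) → R 0 0 → {P : Set} (d : Dec P) {f g : P → ℕ} →
                (∀ p → R (f p) (g p)) → R (restrict d f) (restrict d g)
restrict-lift R R00 (yes p) f~g = f~g p
restrict-lift R R00 (no _)  f~g = R00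

restrict-witness : {P : Set} (d : Dec P) (f : P → ℕ) → 0 < restrict d f → Σ P λ p → 0 < f p
restrict-witness (yes p) f 0<fp = p , 0<fp

restrict-term : {P : Set} → (∀ (p q : P) → p ≡ q) → (d : Dec P) (f : P → ℕ) (p : P) → f p ≤ restrict d f
restrict-term irrelevant (yes q) f p = ≤-reflexive (cong f (irrelevant p q))
restrict-term irrelevant (no ¬p) f p = ⊥-elim (¬p p)

OppositePair : (k : ℕ) → Fin k → Fin k → Set
OppositePair k g g' = toℕ g < toℕ g' × Opposite k (toℕ g) (toℕ g')

oppositePair? : ∀ k g g' → Dec (OppositePair k g g')
oppositePair? k g g' = (toℕ g <? toℕ g') ×-dec opposite? k (toℕ g) (toℕ g')

oppositePair-irrelevant : ∀ {k} → (k ∸ 1) / 2 ≢ (k + 1) / 2 → ∀ {g g'} (p q : OppositePair k g g') → p ≡ q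
oppositePair-irrelevant {k} halves≢ {g} {g'} (g<g' , o) (g<g'' , o') =
  cong₂ _,_ (<-irrelevant g<g' g<g'') (opposite {toℕ g} {toℕ g'} o o')
  where
  opposite : ∀ {x y} (o o' : Opposite k x y) → o ≡ o'
  opposite (inj₁ e) (inj₁ e') = cong inj₁ (≡-irrelevant e e')
  opposite (inj₂ e) (inj₂ e') = cong inj₂ (≡-irrelevant e e')
  opposite (inj₁ e) (inj₂ e') = ⊥-elim (halves≢ (trans (sym e) e'))
  opposite (inj₂ e) (inj₁ e') = ⊥-elim (halves≢ (trans (sym e') e))

module OppositeSums (k ℓ : ℕ) where

  Slot : Set
  Slot = Σ (Fin k) λ g → Σ (Fin k) λ g' → OppositePair k g g' × Fin ℓ

  cell : (Slot → ℕ) → Fin k → Fin k → ℕ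
  cell w g g' = restrict (oppositePair? k g g') λ pr → sumFin λ t → w (g , g' , pr , t)

  ΣSlot : (Slot → ℕ) → ℕ
  ΣSlot w = sumFin λ g → sumFin (cell w g)

  ΣSlot-lift : (R : ℕ → ℕ → Set) → (∀ {m} {f g : Fin m → ℕ} → (∀ i → R (f i) (g i)) → R (sumFin f) (sumFin g)) →
               R 0 0 → ∀ {v w} → (∀ i → R (v i) (w i)) → R (ΣSlot v) (ΣSlot w)
  ΣSlot-lift R sum-R R00 v~w =
    sum-R λ g → sum-R λ g' → restrict-lift R R00 (oppositePair? k g g') λ pr → sum-R λ t → v~w (g , g' , pr , t)

  ΣSlot-cong : ∀ {v w} → (∀ i → v i ≡ w i) → ΣSlot v ≡ ΣSlot w
  ΣSlot-cong = ΣSlot-lift _≡_ sumFin-cong refl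

  ΣSlot-mono : ∀ {v w} → (∀ i → v i ≤ w i) → ΣSlot v ≤ ΣSlot w
  ΣSlot-mono = ΣSlot-lift _≤_ sumFin-mono z≤n

  ΣSlot-+ : ∀ v w → ΣSlot (λ i → v i + w i) ≡ ΣSlot v + ΣSlot w
  ΣSlot-+ v w = trans (sumFin-cong λ g → trans (sumFin-cong λ g' → cell-+ g g' (oppositePair? k g g')) (sumFin-+ {k} _ _))
                      (sumFin-+ {k} _ _)
    where
    cell-+ : ∀ g g' d → restrict d (λ pr → sumFin λ t → v (g , g' , pr , t) + w (g , g' , pr , t))
                      ≡ restrict d (λ pr → sumFin λ t → v (g , g' , pr , t)) + restrict d (λ pr → sumFin λ t → w (g , g' , pr , t))
    cell-+ g g' (yes pr) = sumFin-+ {ℓ} _ _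
    cell-+ g g' (no _)   = refl

  ΣSlot-*ˡ : ∀ c w → ΣSlot (λ i → c * w i) ≡ c * ΣSlot w
  ΣSlot-*ˡ c w = trans (sumFin-cong λ g → trans (sumFin-cong λ g' → cell-* g g' (oppositePair? k g g')) (sumFin-*ˡ {k} c _))
                       (sumFin-*ˡ {k} c _)
    where
    cell-* : ∀ g g' d → restrict d (λ pr → sumFin λ t → c * w (g , g' , pr , t))
                      ≡ c * restrict d (λ pr → sumFin λ t → w (g , g' , pr , t))
    cell-* g g' (yes pr) = sumFin-*ˡ {ℓ} c _
    cell-* g g' (no _)   = sym (*-zeroʳ c)

  ΣSlot-comm : ∀ {m} (w : Fin m → Slot → ℕ) → sumFin (λ p → ΣSlot (w p)) ≡ ΣSlot (λ i → sumFin (λ p → w p i))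
  ΣSlot-comm {m} w =
    trans (sumFin-comm (λ p g → sumFin (cell (w p) g)))
          (sumFin-cong λ g → trans (sumFin-comm (λ p g' → cell (w p) g g'))
                                   (sumFin-cong λ g' → cell-comm g g' (oppositePair? k g g')))
    where
    cell-comm : ∀ g g' d → sumFin {m} (λ p → restrict d (λ pr → sumFin λ t → w p (g , g' , pr , t)))
                         ≡ restrict d (λ pr → sumFin λ t → sumFin λ p → w p (g , g' , pr , t))
    cell-comm g g' (yes pr) = sumFin-comm (λ p t → w p (g , g' , pr , t))
    cell-comm g g' (no _)   = sumFin-≡0 {m} (λ _ → refl)

  ΣSlot-1 : ΣSlot (λ _ → 1) ≡ ℓ * sumFin (λ g → sumFin (λ g' → 𝟙 (oppositePair? k g g')))
  ΣSlot-1 = begin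
    ΣSlot (λ _ → 1)
      ≡⟨ sumFin-cong (λ g → sumFin-cong (λ g' → cell-1 (oppositePair? k g g'))) ⟩
    sumFin (λ g → sumFin (λ g' → ℓ * 𝟙 (oppositePair? k g g')))
      ≡⟨ sumFin-cong (λ g → sumFin-*ˡ ℓ (λ g' → 𝟙 (oppositePair? k g g'))) ⟩
    sumFin (λ g → ℓ * sumFin (λ g' → 𝟙 (oppositePair? k g g')))      ≡⟨ sumFin-*ˡ {k} ℓ _ ⟩
    ℓ * sumFin (λ g → sumFin (λ g' → 𝟙 (oppositePair? k g g')))      ∎
    where
    open ≡-Reasoning
    cell-1 : {P : Set} (d : Dec P) → restrict d (λ _ → sumFin {ℓ} (λ _ → 1)) ≡ ℓ * 𝟙 d
    cell-1 (yes _) = sumFin-const ℓ 1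
    cell-1 (no _)  = sym (*-zeroʳ ℓ)

  cell-witness : ∀ w g g' → 0 < cell w g g' → Σ (OppositePair k g g') λ pr → Σ (Fin ℓ) λ t → 0 < w (g , g' , pr , t)
  cell-witness w g g' 0<cell with restrict-witness (oppositePair? k g g') _ 0<cell
  ... | pr , 0<row = pr , sumFin-witness _ 0<row

  ΣSlot-witness : ∀ w → 0 < ΣSlot w → Σ Slot λ i → 0 < w i
  ΣSlot-witness w 0<Σ with sumFin-witness _ 0<Σ
  ... | g , 0<row with sumFin-witness _ 0<row
  ...   | g' , 0<cell with cell-witness w g g' 0<cell
  ...     | pr , t , 0<w = (g , g' , pr , t) , 0<w

  ΣSlot-≤1 : ∀ w → (∀ i → w i ≤ 1) → (∀ i j → 0 < w i → 0 < w j → i ≡ j) → ΣSlot w ≤ 1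
  ΣSlot-≤1 w w≤1 unique = sumFin-≤1-unique _ row≤1 row-unique
    where
    cell≤1 : ∀ g g' → cell w g g' ≤ 1
    cell≤1 g g' with oppositePair? k g g'
    ... | yes pr = sumFin-≤1-unique _ (λ t → w≤1 _) λ t s p q → cong (proj₂ ∘ proj₂ ∘ proj₂) (unique _ _ p q)
    ... | no _   = z≤n
    row≤1 : ∀ g → sumFin (cell w g) ≤ 1
    row≤1 g = sumFin-≤1-unique _ (cell≤1 g) λ g' g'' p q →
      let (pr , t , p′) = cell-witness w g g' p ; (pr' , t' , q′) = cell-witness w g g'' q
      in cong (proj₁ ∘ proj₂) (unique (g , g' , pr , t) (g , g'' , pr' , t') p′ q′)
    row-unique : ∀ g h → 0 < sumFin (cell w g) → 0 < sumFin (cell w h) → g ≡ h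
    row-unique g h p q =
      let (g' , p₁) = sumFin-witness _ p ; (pr , t , p′) = cell-witness w g g' p₁
          (h' , q₁) = sumFin-witness _ q ; (pr' , t' , q′) = cell-witness w h h' q₁
      in cong proj₁ (unique (g , g' , pr , t) (h , h' , pr' , t') p′ q′)

  ΣSlot-term : (∀ {g g'} (p q : OppositePair k g g') → p ≡ q) → ∀ w i → w i ≤ ΣSlot w
  ΣSlot-term irrelevant w (g , g' , pr , t) = begin
    w (g , g' , pr , t)                        ≤⟨ sumFin-term _ t ⟩
    sumFin (λ t → w (g , g' , pr , t))         ≤⟨ restrict-term irrelevant (oppositePair? k g g') _ pr ⟩
    cell w g g'                                ≤⟨ sumFin-term _ g' ⟩
    sumFin (cell w g)                          ≤⟨ sumFin-term _ g ⟩
    ΣSlot w                                    ∎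
    where open ≤-Reasoning

  module ForcedSlots {n} (col : Edge (k * ℓ) → Fin n) (F : ForcedFamily k ℓ) where

    forced : Slot → Edge (k * ℓ)
    forced (g , g' , (g<g' , opposite) , t) = F g g' g<g' opposite t

    inClass : Fin n → Slot → ℕ
    inClass c i = 𝟙 (col (forced i) Fin.≟ c)

    -- forcedCount sums a where-bound function of Defs, which summand names by unification.
    summand : Σ (Fin n → Fin k → Fin k → ℕ) λ Q → ∀ c → forcedCount k ℓ col F c ≡ sumFin λ g → sumFin λ g' → Q c g g'
    summand = _ , λ c → refl

    forcedCount≡ΣSlot : ∀ c → forcedCount k ℓ col F c ≡ ΣSlot (inClass c)
    forcedCount≡ΣSlot c = trans (proj₂ summand c) (sumFin-cong λ g → sumFin-cong λ g' → summand≡ g g')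
      where
      summand≡ : ∀ g g' → proj₁ summand c g g' ≡ cell (inClass c) g g'
      summand≡ g g' with oppositePair? k g g'
      ... | yes _ = refl
      ... | no _  = refl

    sum-forcedCount : sumFin (forcedCount k ℓ col F) ≡ ℓ * sumFin (λ g → sumFin (λ g' → 𝟙 (oppositePair? k g g')))
    sum-forcedCount = begin
      sumFin (forcedCount k ℓ col F)            ≡⟨ sumFin-cong forcedCount≡ΣSlot ⟩
      sumFin (λ c → ΣSlot (inClass c))          ≡⟨ ΣSlot-comm inClass ⟩
      ΣSlot (λ i → sumFin (λ c → inClass c i))  ≡⟨ ΣSlot-cong (λ i → count-Fin≡ (col (forced i))) ⟩
      ΣSlot (λ _ → 1)                           ≡⟨ ΣSlot-1 ⟩
      ℓ * sumFin (λ g → sumFin (λ g' → 𝟙 (oppositePair? k g g')))  ∎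
      where open ≡-Reasoning

module OddGroups (a : ℕ) where

  k : ℕ
  k = 3 + 2 * a

  k≡ : k ≡ suc (suc a) + suc a
  k≡ = identity a
    where
    identity : ∀ a → 3 + 2 * a ≡ suc (suc a) + suc a
    identity = solve-∀

  half-pred : (k ∸ 1) / 2 ≡ suc a
  half-pred = trans (cong (_/ 2) (identity a)) (m*n/n≡m (suc a) 2)
    where
    identity : ∀ a → 2 + 2 * a ≡ suc a * 2
    identity = solve-∀

  half-suc : (k + 1) / 2 ≡ suc (suc a)
  half-suc = trans (cong (_/ 2) (identity a)) (m*n/n≡m (suc (suc a)) 2)
    where
    identity : ∀ a → 3 + 2 * a + 1 ≡ suc (suc a) * 2
    identity = solve-∀

  halves≢ : (k ∸ 1) / 2 ≢ (k + 1) / 2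
  halves≢ eq = <-irrefl (trans (sym half-pred) (trans eq half-suc)) (n<1+n (suc a))

  opposite-split : ∀ g g' → 𝟙 (oppositePair? k g g') ≡ 𝟙 (toℕ g' ≟ toℕ g + suc a) + 𝟙 (toℕ g' ≟ toℕ g + suc (suc a))
  opposite-split g g' = sym (𝟙-⊎ (toℕ g' ≟ toℕ g + suc a) (toℕ g' ≟ toℕ g + suc (suc a)) (oppositePair? k g g') to from disjoint)
    where
    G G' : ℕ
    G  = toℕ g
    G' = toℕ g'
    offset : ∀ {x y d} → y ≡ x + suc d → x < y × y ∸ x ≡ suc d
    offset {x} refl = m<m+n x (s≤s z≤n) , m+n∸m≡n x _
    to : G' ≡ G + suc a ⊎ G' ≡ G + suc (suc a) → OppositePair k g g'
    to (inj₁ e) = Data.Product.map₂ (λ diff → inj₁ (trans diff (sym half-pred))) (offset e)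
    to (inj₂ e) = Data.Product.map₂ (λ diff → inj₂ (trans diff (sym half-suc))) (offset e)
    back : ∀ {d} → G < G' → G' ∸ G ≡ d → G' ≡ G + d
    back G<G' diff = trans (sym (m+[n∸m]≡n (<⇒≤ G<G'))) (cong (G +_) diff)
    from : OppositePair k g g' → G' ≡ G + suc a ⊎ G' ≡ G + suc (suc a)
    from (G<G' , inj₁ diff) = inj₁ (back G<G' (trans diff half-pred))
    from (G<G' , inj₂ diff) = inj₂ (back G<G' (trans diff half-suc))
    disjoint : G' ≡ G + suc a → ¬ G' ≡ G + suc (suc a)
    disjoint e e' = <-irrefl (+-cancelˡ-≡ G _ _ (trans (sym e) e')) (n<1+n (suc a))

  opposite-pair-count : sumFin {k} (λ g → sumFin {k} (λ g' → 𝟙 (oppositePair? k g g'))) ≡ k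
  opposite-pair-count = begin
    sumFin {k} (λ g → sumFin {k} (λ g' → 𝟙 (oppositePair? k g g')))
      ≡⟨ sumFin-cong {k} (λ g → trans (sumFin-cong {k} (opposite-split g))
                                      (sumFin-+ {k} (λ g' → 𝟙 (toℕ g' ≟ toℕ g + suc a))
                                                    (λ g' → 𝟙 (toℕ g' ≟ toℕ g + suc (suc a))))) ⟩
    sumFin {k} (λ g → sumFin {k} (λ g' → 𝟙 (toℕ g' ≟ toℕ g + suc a))
                    + sumFin {k} (λ g' → 𝟙 (toℕ g' ≟ toℕ g + suc (suc a))))
      ≡⟨ sumFin-cong {k} (λ g → cong₂ _+_ (count-≡ {k} (toℕ g + suc a)) (count-≡ {k} (toℕ g + suc (suc a)))) ⟩
    sumFin {k} (λ g → 𝟙 (toℕ g + suc a <? k) + 𝟙 (toℕ g + suc (suc a) <? k))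
      ≡⟨ sumFin-+ {k} (λ g → 𝟙 (toℕ g + suc a <? k)) (λ g → 𝟙 (toℕ g + suc (suc a) <? k)) ⟩
    sumFin {k} (λ g → 𝟙 (toℕ g + suc a <? k)) + sumFin {k} (λ g → 𝟙 (toℕ g + suc (suc a) <? k))
      ≡⟨ cong₂ _+_ (count-+< k (suc a) (subst (suc a ≤_) (sym k≡) (m≤n+m (suc a) (suc (suc a)))))
                   (count-+< k (suc (suc a)) (subst (suc (suc a) ≤_) (sym k≡) (m≤m+n _ _))) ⟩
    (k ∸ suc a) + (k ∸ suc (suc a))
      ≡⟨ cong₂ _+_ (cong (_∸ suc a) k≡) (cong (_∸ suc (suc a)) k≡) ⟩
    (suc (suc a) + suc a ∸ suc a) + (suc (suc a) + suc a ∸ suc (suc a))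
      ≡⟨ cong₂ _+_ (m+n∸n≡m (suc (suc a)) (suc a)) (m+n∸m≡n (suc (suc a)) (suc a)) ⟩
    suc (suc a) + suc a
      ≡⟨ k≡ ⟨
    k ∎
    where open ≡-Reasoning


-- Colour classes

module ColourClasses (k ℓ : ℕ) {{_ : NonZero ℓ}} (m D : ℕ) (N≡ : k * ℓ ≡ suc (m + m)) (2≤m : 2 ≤ m)
                    (N≤3D : k * ℓ ≤ D * 3) (D<m : D < m) (halves≢ : (k ∸ 1) / 2 ≢ (k + 1) / 2)
                    (D≤d : ∀ (t : Fin ℓ) → D ≤ dd k ℓ (suc (toℕ t))) where
  open Chords k ℓ
  open Halving k ℓ m N≡ 2≤m
  open OppositeSums k ℓ

  module _ (col : Edge N → Fin (suc m)) (plane : AllPlane k ℓ col)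
           (F : ForcedFamily k ℓ) (isForced : IsForced k ℓ col F) where

    open ForcedSlots col F

    forced-maximal : ∀ i → MaximalIn k ℓ col (forced i)
    forced-maximal (g , g' , (g<g' , opposite) , t) = proj₁ (proj₂ (proj₂ (proj₂ isForced g g' g<g' opposite t)))

    forced-dist : ∀ i → D ≤ dist k ℓ (forced i)
    forced-dist (g , g' , (g<g' , opposite) , t) = ≤-trans (D≤d t) (proj₂ (proj₂ (proj₂ (proj₂ isForced g g' g<g' opposite t))))

    forced-injective : ∀ i j → forced i ≡ forced j → i ≡ j
    forced-injective (g , g' , (g<g' , o) , t) (h , h' , (h<h' , o') , s) eq
      with connects-unique (forced (g , g' , (g<g' , o) , t)) g<g' h<h'
             (proj₁ (proj₂ (proj₂ isForced g g' g<g' o t)))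
             (subst (λ e → Connects k ℓ e (toℕ h) (toℕ h')) (sym eq) (proj₁ (proj₂ (proj₂ isForced h h' h<h' o' s))))
    ... | g≡h , g'≡h' with Fin.toℕ-injective g≡h | Fin.toℕ-injective g'≡h'
    ...   | refl | refl with oppositePair-irrelevant halves≢ (g<g' , o) (h<h' , o')
    ...     | refl = cong (λ t → (g , g' , (g<g' , o) , t)) (proj₁ isForced g g' g<g' o t s eq)

    charge : Fin (suc m) → Fin N → ℕ
    charge c p = ΣSlot (λ i → inClass c i * owns (forced i) p)

    sum-charge : ∀ c → sumFin (charge c) ≡ ΣSlot (λ i → inClass c i * dist k ℓ (forced i))
    sum-charge c = trans (ΣSlot-comm (λ p i → inClass c i * owns (forced i) p))
                         (ΣSlot-cong λ i → trans (sumFin-*ˡ (inClass c i) (owns (forced i)))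
                                                 (cong (inClass c i *_) (sum-owns (forced i))))

    forced-owner : ∀ c i p → 0 < inClass c i * owns (forced i) p → col (forced i) ≡ c × 0 < owns (forced i) p
    forced-owner c i p = 𝟙*-witness (col (forced i) Fin.≟ c) (owns (forced i) p)

    charge≤1 : ∀ c p → charge c p ≤ 1
    charge≤1 c p = ΣSlot-≤1 _ (λ i → *-mono-≤ (𝟙≤1 (col (forced i) Fin.≟ c)) (owns≤1 (forced i) p)) unique
      where
      unique : ∀ i j → 0 < inClass c i * owns (forced i) p → 0 < inClass c j * owns (forced j) p → i ≡ j
      unique i j chargedᵢ chargedⱼ with forced-owner c i p chargedᵢ | forced-owner c j p chargedⱼ
      ... | colᵢ , ownsᵢ | colⱼ , ownsⱼ with owners-≤c p (plane _ _ (trans colᵢ (sym colⱼ))) ownsᵢ ownsⱼ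
      ...   | inj₁ i≤j = forced-injective i j (maximal-≤c (forced-maximal i) (trans colⱼ (sym colᵢ)) i≤j)
      ...   | inj₂ j≤i = sym (forced-injective j i (maximal-≤c (forced-maximal j) (trans colᵢ (sym colⱼ)) j≤i))

    charge+owns≤1 : ∀ c h p → col h ≡ c → (∀ i → col (forced i) ≡ c → ¬ h ≤c forced i) → charge c p + owns h p ≤ 1
    charge+owns≤1 c h p h-col unbounded with 0 <? owns h p
    ... | no ¬owns = subst (λ x → charge c p + x ≤ 1) (sym (n≤0⇒n≡0 (≮⇒≥ ¬owns)))
                           (subst (_≤ 1) (sym (+-identityʳ _)) (charge≤1 c p))
    ... | yes owns-h with 0 <? charge c p
    ...   | no ¬charged = subst (λ x → x + owns h p ≤ 1) (sym (n≤0⇒n≡0 (≮⇒≥ ¬charged))) (owns≤1 h p)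
    ...   | yes charged with ΣSlot-witness _ charged
    ...     | i , chargedᵢ with forced-owner c i p chargedᵢ
    ...       | colᵢ , ownsᵢ with owners-≤c p (plane _ _ (trans h-col (sym colᵢ))) owns-h ownsᵢ
    ...         | inj₁ h≤i = ⊥-elim (unbounded i colᵢ h≤i)
    ...         | inj₂ i≤h = ⊥-elim (unbounded i colᵢ (subst (h ≤c_) (sym i≡h) (owner-≤c-refl h p owns-h)))
      where
      i≡h : forced i ≡ h
      i≡h = maximal-≤c {e = forced i} (forced-maximal i) (trans h-col (sym colᵢ)) i≤h

    charged-dist≤N : ∀ c → ΣSlot (λ i → inClass c i * dist k ℓ (forced i)) ≤ N
    charged-dist≤N c = begin
      ΣSlot (λ i → inClass c i * dist k ℓ (forced i))  ≡⟨ sum-charge c ⟨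
      sumFin (charge c)                                 ≤⟨ sumFin-≤-const 1 (charge≤1 c) ⟩
      N * 1                                             ≡⟨ *-identityʳ N ⟩
      N                                                 ∎
      where open ≤-Reasoning

    charged-dist+dist≤N : ∀ c h → col h ≡ c → (∀ i → col (forced i) ≡ c → ¬ h ≤c forced i) →
                          ΣSlot (λ i → inClass c i * dist k ℓ (forced i)) + dist k ℓ h ≤ N
    charged-dist+dist≤N c h h-col unbounded = begin
      ΣSlot (λ i → inClass c i * dist k ℓ (forced i)) + dist k ℓ h  ≡⟨ cong₂ _+_ (sum-charge c) (sum-owns h) ⟨
      sumFin (charge c) + sumFin (owns h)                            ≡⟨ sumFin-+ (charge c) (owns h) ⟨
      sumFin (λ p → charge c p + owns h p)
        ≤⟨ sumFin-≤-const 1 (λ p → charge+owns≤1 c h p h-col unbounded) ⟩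
      N * 1                                                          ≡⟨ *-identityʳ N ⟩
      N                                                              ∎
      where open ≤-Reasoning

    slot-bound : {P Q : Set} (d : Dec P) (b : Dec Q) {x : ℕ} → D ≤ x → (Q → m ≤ x) → D * 𝟙 d + 𝟙 d * 𝟙 b ≤ 𝟙 d * x
    slot-bound (no _)  b       D≤x far = ≤-reflexive (trans (+-identityʳ _) (*-zeroʳ D))
    slot-bound (yes _) (yes q) {x} D≤x far = begin
      D * 1 + 1  ≡⟨ cong (_+ 1) (*-identityʳ D) ⟩
      D + 1      ≡⟨ +-comm D 1 ⟩
      suc D      ≤⟨ D<m ⟩
      m          ≤⟨ far q ⟩
      x          ≡⟨ +-identityʳ x ⟨
      x + 0      ∎
      where open ≤-Reasoning
    slot-bound (yes _) (no _)  {x} D≤x far = begin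
      D * 1 + 0  ≡⟨ trans (+-identityʳ (D * 1)) (*-identityʳ D) ⟩
      D          ≤⟨ D≤x ⟩
      x          ≡⟨ +-identityʳ x ⟨
      x + 0      ∎
      where open ≤-Reasoning

    class-dist-lower : ∀ c h → (∀ e → h ≤c e → m ≤ dist k ℓ e) →
                       D * forcedCount k ℓ col F c + ΣSlot (λ i → inClass c i * 𝟙 (h ≤c? forced i))
                       ≤ ΣSlot (λ i → inClass c i * dist k ℓ (forced i))
    class-dist-lower c h far = begin
      D * forcedCount k ℓ col F c + ΣSlot (λ i → inClass c i * 𝟙 (h ≤c? forced i))
        ≡⟨ cong (_+ _) (trans (cong (D *_) (forcedCount≡ΣSlot c)) (sym (ΣSlot-*ˡ D (inClass c)))) ⟩
      ΣSlot (λ i → D * inClass c i) + ΣSlot (λ i → inClass c i * 𝟙 (h ≤c? forced i))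
        ≡⟨ ΣSlot-+ _ _ ⟨
      ΣSlot (λ i → D * inClass c i + inClass c i * 𝟙 (h ≤c? forced i))
        ≤⟨ ΣSlot-mono (λ i → slot-bound (col (forced i) Fin.≟ c) (h ≤c? forced i) (forced-dist i) (far (forced i))) ⟩
      ΣSlot (λ i → inClass c i * dist k ℓ (forced i))
        ∎
      where open ≤-Reasoning

    large-class-avoids-halving : ∀ c → 3 ≤ forcedCount k ℓ col F c → ∀ t → col (halving t) ≢ c
    large-class-avoids-halving c 3≤count t h-col = <-irrefl refl (begin-strict
      N                            ≤⟨ N≤3D ⟩
      D * 3                        <⟨ m<m+n (D * 3) (≤-trans (s≤s z≤n) 2≤m) ⟩
      D * 3 + m                    ≤⟨ +-mono-≤ (≤-trans (m≤m+n (D * 3) Above) classLower) (dist-halving t) ⟩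
      ΣDist + dist k ℓ (halving t) ≤⟨ charged-dist+dist≤N c (halving t) h-col unbounded ⟩
      N                            ∎)
      where
      open ≤-Reasoning
      ΣDist Above : ℕ
      ΣDist = ΣSlot (λ i → inClass c i * dist k ℓ (forced i))
      Above = ΣSlot (λ i → inClass c i * 𝟙 (halving t ≤c? forced i))
      classLower : D * 3 + Above ≤ ΣDist
      classLower = ≤-trans (+-monoˡ-≤ Above (*-monoʳ-≤ D 3≤count)) (class-dist-lower c (halving t) (halving-≤c⇒dist t))
      unbounded : ∀ i → col (forced i) ≡ c → ¬ halving t ≤c forced i
      unbounded i colᵢ below = <-irrefl refl (begin-strict
        N              ≤⟨ N≤3D ⟩
        D * 3          <⟨ m<m+n (D * 3) 0<Above ⟩
        D * 3 + Above  ≤⟨ classLower ⟩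
        ΣDist          ≤⟨ charged-dist≤N c ⟩
        N              ∎)
        where
        term≡1 : inClass c i * 𝟙 (halving t ≤c? forced i) ≡ 1
        term≡1 = cong₂ _*_ (𝟙-yes (col (forced i) Fin.≟ c) colᵢ) (𝟙-yes (halving t ≤c? forced i) below)
        0<Above : 0 < Above
        0<Above = ≤-trans (≤-reflexive (sym term≡1)) (ΣSlot-term (oppositePair-irrelevant halves≢) _ i)

    forcedCount≤2 : ∀ c → forcedCount k ℓ col F c ≤ 2
    forcedCount≤2 c with forcedCount k ℓ col F c ≤? 2
    ... | yes ≤2 = ≤2
    ... | no ≰2 with halving-in-every-class col plane c
    ...   | t , h-col = ⊥-elim (large-class-avoids-halving c (≰⇒> ≰2) t h-col)

module BW (a b : ℕ) where
  open OddGroups a using (k; halves≢; half-suc; opposite-pair-count)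

  ℓ : ℕ
  ℓ = 3 + 2 * b

  m : ℕ
  m = 4 + 3 * a + 3 * b + 2 * a * b

  -- There are m + 1 colours and 2m + 1 hull points; D = d_ℓ bounds the distance of forced edges.
  D : ℕ
  D = suc a * ℓ

  N≡ : k * ℓ ≡ suc (m + m)
  N≡ = identity a b
    where
    identity : ∀ a b → (3 + 2 * a) * (3 + 2 * b) ≡ suc ((4 + 3 * a + 3 * b + 2 * a * b) + (4 + 3 * a + 3 * b + 2 * a * b))
    identity = solve-∀

  colours≡ : (k * ℓ + 1) / 2 ≡ suc m
  colours≡ = trans (cong (λ x → (x + 1) / 2) N≡) (trans (cong (_/ 2) (identity m)) (m*n/n≡m (suc m) 2))
    where
    identity : ∀ m → suc (m + m) + 1 ≡ suc m * 2
    identity = solve-∀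

  N≤3D : k * ℓ ≤ D * 3
  N≤3D = subst (k * ℓ ≤_) (identity a b) (m≤m+n (k * ℓ) (a * ℓ))
    where
    identity : ∀ a b → (3 + 2 * a) * (3 + 2 * b) + a * (3 + 2 * b) ≡ suc a * (3 + 2 * b) * 3
    identity = solve-∀

  D<m : D < m
  D<m = subst (D <_) (identity a b) (m≤m+n (suc D) b)
    where
    identity : ∀ a b → suc (suc a * (3 + 2 * b)) + b ≡ 4 + 3 * a + 3 * b + 2 * a * b
    identity = solve-∀

  D≤d : ∀ (t : Fin ℓ) → D ≤ dd k ℓ (suc (toℕ t))
  D≤d t = begin
    D                                      ≤⟨ m≤n+m D (ℓ ∸ suc (toℕ t)) ⟩
    ℓ ∸ suc (toℕ t) + D                    ≡⟨ +-∸-comm D (Fin.toℕ<n t) ⟨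
    ℓ + D ∸ suc (toℕ t)                    ≡⟨ cong (λ h → h * ℓ ∸ suc (toℕ t)) half-suc ⟨
    dd k ℓ (suc (toℕ t))                   ∎
    where open ≤-Reasoning

  one-class-of-size-one : (col : Edge (k * ℓ) → Fin (suc m)) → AllPlane k ℓ col →
                          (F : ForcedFamily k ℓ) → IsForced k ℓ col F →
                          Σ (Fin (suc m)) λ c₀ → forcedCount k ℓ col F c₀ ≡ 1
                                               × (∀ c → c ≢ c₀ → forcedCount k ℓ col F c ≡ 2)
  one-class-of-size-one col plane F isForced =
    one-and-twos (forcedCount k ℓ col F)
                 (ColourClasses.forcedCount≤2 k ℓ m D N≡ (s≤s (s≤s z≤n)) N≤3D D<m halves≢ D≤d col plane F isForced)
                 (begin
                   sumFin (forcedCount k ℓ col F)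
                     ≡⟨ OppositeSums.ForcedSlots.sum-forcedCount k ℓ col F ⟩
                   ℓ * sumFin {k} (λ g → sumFin {k} (λ g' → 𝟙 (oppositePair? k g g')))
                     ≡⟨ cong (ℓ *_) opposite-pair-count ⟩
                   ℓ * k                           ≡⟨ *-comm ℓ k ⟩
                   k * ℓ                           ≡⟨ N≡ ⟩
                   suc (m + m)                     ∎)
    where open ≡-Reasoning

proposition21 : (a b : ℕ) →
    let k = 3 + 2 * a
        ℓ = 3 + 2 * b
        n = (k * ℓ + 1) / 2
    in (col : Edge (k * ℓ) → Fin n) → AllPlane k ℓ col →
       (F : ForcedFamily k ℓ) → IsForced k ℓ col F →
       Σ (Fin n) (λ c₀ → (forcedCount k ℓ col F c₀ ≡ 1)
                       × ((c : Fin n) → c ≢ c₀ → forcedCount k ℓ col F c ≡ 2))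
proposition21 a b = subst Conclusion (sym colours≡) one-class-of-size-one
  where
  open OddGroups a using (k)
  open BW a b using (ℓ; colours≡; one-class-of-size-one)
  Conclusion : ℕ → Set
  Conclusion n = (col : Edge (k * ℓ) → Fin n) → AllPlane k ℓ col →
                 (F : ForcedFamily k ℓ) → IsForced k ℓ col F →
                 Σ (Fin n) (λ c₀ → (forcedCount k ℓ col F c₀ ≡ 1)
                                 × ((c : Fin n) → c ≢ c₀ → forcedCount k ℓ col F c ≡ 2))
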